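{- Let $P$ be a pure finite poset of length $r$ and let $M$ be the set of maximal elements of $P$. Suppose that the order complex of $P$ is shellable, with shelling order $\Omega$ of the maximal chains of $P$, and that $P$ is acyclic (its order complex has vanishing reduced integral homology). Then: (i) $\mathcal{F}(P\setminus M)=\biguplus_{m\in M}\mathcal{F}(P_{<m})$ (in particular the sets $\mathcal{F}(P_{<m})$, $m\in M$, are pairwise disjoint); (ii) $\biguplus_{m\in M}B(P_{<m})$ is a basis for $\widetilde H_{r-1}(P\setminus M)$.
   Context: The homology of a poset means the reduced simplicial homology (over $\mathbb{Z}$) of its order complex, whose faces are the chains. For $m\in P$, $P_{<m}=\{y\in P: y<m\}$. For a shelling order of the facets of a pure complex, the restriction $\mathcal{R}(F)$ of a facet $F$ is the set of vertices $x\in F$ such that $F\setminus\{x\}$ is contained in a facet earlier in the order; $F$ is a full restriction facet if $\mathcal{R}(F)=F$. The shelling $\Omega$ induces: (a) for each $m\in M$, a shelling order $\Omega^{<m}$ of the maximal chains of $P_{<m}$, where $c$ precedes $c'$ iff $c\cup\{m\}$ precedes $c'\cup\{m\}$ in $\Omega$; (b) a shelling order $\Omega^{P\setminus M}$ of the maximal chains of $P\setminus M$, where each maximal chain $c$ of $P\setminus M$ is mapped to its $\Omega$-earliest extension $\varphi(c)=c\cup\{m\}$, $m\in M$, and $c$ precedes $c'$ iff $\varphi(c)$ precedes $\varphi(c')$ in $\Omega$. $\mathcal{F}(P_{<m})$ and $\mathcal{F}(P\setminus M)$ denote the sets of full restriction facets for $\Omega^{<m}$ and $\Omega^{P\setminus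 M}$ respectively. $B(P_{<m})=\{\rho_F\}_{F\in\mathcal{F}(P_{<m})}$ is the shelling basis of $\widetilde H_{r-1}(P_{<m})$, i.e. the set of $(r-1)$-cycles of $P_{<m}$ characterized by $\langle\rho_F,F'\rangle=\delta_{F,F'}$ for all $F,F'\in\mathcal{F}(P_{<m})$, where $\langle\rho,F'\rangle$ is the coefficient of the chain $F'$ in $\rho$. Cycles of $P_{<m}$ are regarded as cycles of $P\setminus M$. -}

module Defs where

open import Level using (0ℓ)
open import Data.Nat as ℕ using (ℕ; zero; suc)
open import Data.Fin as Fin using (Fin; zero; suc)
open import Data.Bool using (Bool; true; false; if_then_else_)
open import Data.Vec using (_∷_; []; lookup)
open import Data.Integer as ℤ using (ℤ; 0ℤ; 1ℤ; -1ℤ)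
open import Data.Fin.Subset using (Subset; _∈_; _∉_; _⊆_; _∩_; _∪_; _-_; ⁅_⁆; ∣_∣)
open import Data.Product using (Σ; ∃; ∃₂; _×_; _,_)
open import Data.Sum using (_⊎_)
open import Data.Unit using (⊤)
open import Relation.Nullary using (¬_; ⌊_⌋)
open import Relation.Binary using (Rel; Decidable; IsStrictPartialOrder)
open import Relation.Binary.PropositionalEquality using (_≡_; _≢_)
open import Function.Definitions using (Injective)

sumFin : ∀ {n} → (Fin n → ℤ) → ℤ
sumFin {zero}  f = 0ℤ
sumFin {suc n} f = f zero ℤ.+ sumFin (λ i → f (suc i))

sumSub : ∀ {n} → (Subset n → ℤ) → ℤ
sumSub {zero}  f = f []
sumSub {suc n} f = sumSub (λ s → f (false ∷ s)) ℤ.+ sumSub (λ s → f (true ∷ s))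

record FinPoset (n : ℕ) : Set₁ where
  field
    _<_   : Rel (Fin n) 0ℓ
    isSPO : IsStrictPartialOrder _≡_ _<_
    _<?_  : Decidable _<_

module Poset {n : ℕ} (P : FinPoset n) where
  open FinPoset P

  SubPoset : Set₁
  SubPoset = Fin n → Set

  whole : SubPoset
  whole _ = ⊤

  IsMaximal : Fin n → Set
  IsMaximal m = ∀ y → ¬ (m < y)

  belowTop : SubPoset
  belowTop x = ¬ IsMaximal x

  below : Fin n → SubPoset
  below m x = x < m

  -- faces of the order complex of Q: chains (as subsets) of elements of Q
  ChainIn : SubPoset → Subset n → Set
  ChainIn Q σ = (∀ x → x ∈ σ → Q x)
              × (∀ x y → x ∈ σ → y ∈ σ → x ≢ y → (x < y) ⊎ (y < x))

  MaxChainIn : SubPoset → Subset n → Set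
  MaxChainIn Q σ = ChainIn Q σ × (∀ v → v ∉ σ → ¬ ChainIn Q (σ ∪ ⁅ v ⁆))

  PureOfLength : ℕ → Set
  PureOfLength r = ∀ σ → MaxChainIn whole σ → ∣ σ ∣ ≡ suc r

  IsShellingOrder : (N : ℕ) → (Fin N → Subset n) → Set
  IsShellingOrder N Ω =
      Injective _≡_ _≡_ Ω
    × (∀ i → MaxChainIn whole (Ω i))
    × (∀ σ → MaxChainIn whole σ → ∃ λ i → Ω i ≡ σ)
    × (∀ i j → i Fin.< j → ∃ λ k → k Fin.< j
          × (Ω i ∩ Ω j ⊆ Ω k ∩ Ω j)
          × (suc ∣ Ω k ∩ Ω j ∣ ≡ ∣ Ω j ∣))

  -- Full restriction facets w.r.t. an order "prec c' c" (c' precedes c)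
  -- on the facets of the order complex of Q.

  FullRestriction : SubPoset → (Subset n → Subset n → Set) → Subset n → Set
  FullRestriction Q prec c =
      MaxChainIn Q c
    × (∀ x → x ∈ c → ∃ λ c' → MaxChainIn Q c' × prec c' c × (c - x ⊆ c'))

  module Induced {N : ℕ} (Ω : Fin N → Subset n) where

    PrecBelow : Fin n → Subset n → Subset n → Set
    PrecBelow m c c' = ∃₂ λ i j → Ω i ≡ c ∪ ⁅ m ⁆ × Ω j ≡ c' ∪ ⁅ m ⁆ × i Fin.< j

    IsExtension : Subset n → Fin N → Set
    IsExtension c i = ∃ λ m → IsMaximal m × Ω i ≡ c ∪ ⁅ m ⁆

    EarliestExtension : Subset n → Fin N → Set
    EarliestExtension c i = IsExtension c i × (∀ i' → IsExtension c i' → i Fin.≤ i')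

    PrecBelowTop : Subset n → Subset n → Set
    PrecBelowTop c c' = ∃₂ λ i j → EarliestExtension c i × EarliestExtension c' j × i Fin.< j

    𝓕Below : Fin n → Subset n → Set
    𝓕Below m = FullRestriction (below m) (PrecBelow m)

    𝓕BelowTop : Subset n → Set
    𝓕BelowTop = FullRestriction belowTop PrecBelowTop

  -- A chain is a function Subset n → ℤ; a k-chain of Q is supported on
  -- faces of Q with s = k+1 elements (s = 0: the empty face, degree -1).
  -- Faces are oriented by the order of P.

  ZChain : Set
  ZChain = Subset n → ℤ

  SupportedOn : SubPoset → ℕ → ZChain → Set
  SupportedOn Q s c = ∀ σ → c σ ≢ 0ℤ → ChainIn Q σ × ∣ σ ∣ ≡ s

  position : Subset n → Fin n → ℕ
  position σ v = ℤ.∣ sumFin (λ u → if lookup σ u then (if ⌊ u <? v ⌋ then 1ℤ else 0ℤ) else 0ℤ) ∣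

  ∂ : ZChain → ZChain
  ∂ c σ = sumFin (λ v → if lookup σ v then 0ℤ
                        else (-1ℤ ℤ.^ position σ v) ℤ.* c (σ ∪ ⁅ v ⁆))

  Cycle : SubPoset → ℕ → ZChain → Set
  Cycle Q s z = SupportedOn Q s z × (∀ σ → ∂ z σ ≡ 0ℤ)

  Acyclic : SubPoset → Set
  Acyclic Q = ∀ s z → Cycle Q s z →
              ∃ λ d → SupportedOn Q (suc s) d × (∀ σ → ∂ d σ ≡ z σ)

  combination : (Fin n → Subset n → ℤ) → (Fin n → Subset n → ZChain) → ZChain
  combination a ρ σ = sumFin (λ m → sumSub (λ c → a m c ℤ.* ρ m c σ))

  Coeffs : (Fin n → Subset n → Set) → Set
  Coeffs I = Σ (Fin n → Subset n → ℤ) λ a → ∀ m c → a m c ≢ 0ℤ → I m c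

  IsHomologyBasis : SubPoset → ℕ → (Fin n → Subset n → Set)
                  → (Fin n → Subset n → ZChain) → Set
  IsHomologyBasis Q s I ρ =
      (∀ m c → I m c → Cycle Q s (ρ m c))
    × (∀ z → Cycle Q s z → Σ (Coeffs I) λ { (a , _) →
          ∃ λ d → SupportedOn Q (suc s) d
                × (∀ σ → z σ ≡ combination a ρ σ ℤ.+ ∂ d σ) })
    × (∀ (a : Coeffs I) d → SupportedOn Q (suc s) d
          → (∀ σ → combination (Data.Product.proj₁ a) ρ σ ≡ ∂ d σ)
          → ∀ m c → Data.Product.proj₁ a m c ≡ 0ℤ)

{-# OPTIONS --safe #-}
module Submission where

-- An acyclic pure shellable complex has no full restriction facet: if Ω j were full, ∂(Ω j) would be a
-- codimension-one cycle on the earlier facets, and such cycles of a shelled subcomplex bound chains of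
-- its facets, leaving a nonzero top-dimensional cycle.  Hence for a full restriction facet c of P_{<m}
-- no earlier facet contains c, so c ∪ {m} is the Ω-earliest extension φ(c); comparing the induced
-- orders through φ gives (i).  For (ii), index ρ m F by the position of F ∪ {m} in Ω: ρ m F is supported
-- on chains whose extension by m comes no later, so the family is unitriangular with respect to φ.
-- Independence follows by downward induction, and spanning by repeatedly subtracting the basis element
-- of the chain of latest φ in the support, which is a full restriction facet of P ∖ M.

open import Data.Nat as ℕ using (ℕ; zero; suc)
import Data.Nat.Properties as ℕP
open import Data.Fin as Fin using (Fin; zero; suc; toℕ)
import Data.Fin.Induction as FinInd
open import Induction.WellFounded using (module All)
open import Level using (0ℓ)
import Data.Fin.Properties as FinP
open import Data.Bool using (true; false; if_then_else_; _∨_; _∧_)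
import Data.Bool.Properties as BoolP
open import Data.Vec using (_∷_; []; lookup; here; there)
open import Data.Vec.Properties using ([]=⇒lookup; lookup⇒[]=; lookup-zipWith; ∷-injectiveʳ; ≡-dec)
open import Data.Integer using (ℤ; 0ℤ; 1ℤ; -1ℤ; _+_; _*_; -_; _^_; _≟_)
import Data.Integer as ℤ
open import Data.Integer.Tactic.RingSolver using (solve-∀)
import Data.Integer.Properties as ℤP
open import Data.Fin.Subset
open import Data.Fin.Subset.Properties
open import Data.Product using (Σ; ∃; _×_; _,_; proj₁; proj₂)
open import Data.Sum using (_⊎_; inj₁; inj₂)
open import Data.Empty using (⊥-elim)
open import Data.Unit using (tt)
open import Data.List using (List; []; _∷_; allFin)
open import Data.List.Relation.Unary.Any as Any using ()
open import Data.List.Membership.Propositional as List using ()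
open import Data.List.Membership.Propositional.Properties using (∈-allFin)
open import Function using (_∘_; flip; case_of_)
open import Relation.Nullary using (¬_; Dec; yes; no; ¬?; ⌊_⌋; _×-dec_; _→-dec_; _⊎-dec_)
open import Relation.Nullary.Decidable using (decidable-stable)
open import Relation.Binary using (IsStrictPartialOrder; tri<; tri≈; tri>)
open import Relation.Binary.PropositionalEquality
open import Algebra.Properties.Semiring.Sum ℤP.+-*-semiring using (sum; ∑-distrib-+; ∑-comm; *-distribˡ-sum)
open import Algebra.Properties.CommutativeSemigroup ℤP.+-commutativeSemigroup using (interchange)
open import Defs

sumFin≡sum : ∀ {n} (f : Fin n → ℤ) → sumFin f ≡ sum f
sumFin≡sum {zero}  f = refl
sumFin≡sum {suc n} f = cong (f zero +_) (sumFin≡sum (f ∘ suc))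

sumFin-cong : ∀ {n} {f g : Fin n → ℤ} → (∀ i → f i ≡ g i) → sumFin f ≡ sumFin g
sumFin-cong {zero}  f≗g = refl
sumFin-cong {suc n} f≗g = cong₂ _+_ (f≗g zero) (sumFin-cong (f≗g ∘ suc))

sumFin-zero : ∀ {n} (f : Fin n → ℤ) → (∀ i → f i ≡ 0ℤ) → sumFin f ≡ 0ℤ
sumFin-zero {zero}  f f≗0 = refl
sumFin-zero {suc n} f f≗0 = cong₂ _+_ (f≗0 zero) (sumFin-zero (f ∘ suc) (f≗0 ∘ suc))

sumFin-distrib-+ : ∀ {n} (f g : Fin n → ℤ) →
                   sumFin (λ i → f i + g i) ≡ sumFin f + sumFin g
sumFin-distrib-+ f g = begin
  sumFin (λ i → f i + g i) ≡⟨ sumFin≡sum (λ i → f i + g i) ⟩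
  sum (λ i → f i + g i)    ≡⟨ ∑-distrib-+ f g ⟩
  sum f + sum g            ≡⟨ cong₂ _+_ (sumFin≡sum f) (sumFin≡sum g) ⟨
  sumFin f + sumFin g      ∎
  where open ≡-Reasoning

*-distribˡ-sumFin : ∀ {n} k (f : Fin n → ℤ) → k * sumFin f ≡ sumFin (λ i → k * f i)
*-distribˡ-sumFin k f = begin
  k * sumFin f          ≡⟨ cong (k *_) (sumFin≡sum f) ⟩
  k * sum f             ≡⟨ *-distribˡ-sum k f ⟩
  sum (λ i → k * f i)    ≡⟨ sumFin≡sum (λ i → k * f i) ⟨
  sumFin (λ i → k * f i) ∎
  where open ≡-Reasoning

sumFin-comm : ∀ {m n} (f : Fin m → Fin n → ℤ) →
              sumFin (λ i → sumFin (f i)) ≡ sumFin (λ j → sumFin (λ i → f i j))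
sumFin-comm f = begin
  sumFin (λ i → sumFin (f i))              ≡⟨ sumFin-cong (λ i → sumFin≡sum (f i)) ⟩
  sumFin (λ i → sum (f i))                 ≡⟨ sumFin≡sum (λ i → sum (f i)) ⟩
  sum (λ i → sum (f i))                    ≡⟨ ∑-comm f ⟩
  sum (λ j → sum (λ i → f i j))            ≡⟨ sumFin≡sum (λ j → sum (λ i → f i j)) ⟨
  sumFin (λ j → sum (λ i → f i j))         ≡⟨ sumFin-cong (λ j → sumFin≡sum (λ i → f i j)) ⟨
  sumFin (λ j → sumFin (λ i → f i j))      ∎
  where open ≡-Reasoning

neg-distrib-sumFin : ∀ {n} (f : Fin n → ℤ) → - sumFin f ≡ sumFin (λ i → - f i)
neg-distrib-sumFin {zero}  f = refl
neg-distrib-sumFin {suc n} f =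
  trans (ℤP.neg-distrib-+ (f zero) _) (cong (- f zero +_) (neg-distrib-sumFin (f ∘ suc)))

sumFin-single : ∀ {n} (f : Fin n → ℤ) a → (∀ i → i ≢ a → f i ≡ 0ℤ) → sumFin f ≡ f a
sumFin-single {suc n} f zero    f≗0 =
  trans (cong (f zero +_) (sumFin-zero (f ∘ suc) (λ i → f≗0 (suc i) λ ()))) (ℤP.+-identityʳ _)
sumFin-single {suc n} f (suc a) f≗0 =
  trans (cong (_+ sumFin (f ∘ suc)) (f≗0 zero λ ()))
        (trans (ℤP.+-identityˡ _) (sumFin-single (f ∘ suc) a (λ i i≢a → f≗0 (suc i) (i≢a ∘ FinP.suc-injective))))

sumFin-nonzero : ∀ {n} (f : Fin n → ℤ) → sumFin f ≢ 0ℤ → ∃ λ i → f i ≢ 0ℤ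
sumFin-nonzero f sum≢0 with FinP.any? (λ i → ¬? (f i ≟ 0ℤ))
... | yes found = found
... | no none = ⊥-elim (sum≢0 (sumFin-zero f λ i →
                  decidable-stable (f i ≟ 0ℤ) (λ fi≢0 → none (i , fi≢0))))

sumSub-cong : ∀ {n} {f g : Subset n → ℤ} → (∀ p → f p ≡ g p) → sumSub f ≡ sumSub g
sumSub-cong {zero}  f≗g = f≗g []
sumSub-cong {suc n} f≗g =
  cong₂ _+_ (sumSub-cong (f≗g ∘ (false ∷_))) (sumSub-cong (f≗g ∘ (true ∷_)))

sumSub-zero : ∀ {n} (f : Subset n → ℤ) → (∀ p → f p ≡ 0ℤ) → sumSub f ≡ 0ℤ
sumSub-zero {zero}  f f≗0 = f≗0 []
sumSub-zero {suc n} f f≗0 =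
  cong₂ _+_ (sumSub-zero _ (f≗0 ∘ (false ∷_))) (sumSub-zero _ (f≗0 ∘ (true ∷_)))

sumSub-distrib-+ : ∀ {n} (f g : Subset n → ℤ) →
                   sumSub (λ p → f p + g p) ≡ sumSub f + sumSub g
sumSub-distrib-+ {zero}  f g = refl
sumSub-distrib-+ {suc n} f g = begin
  sumSub (λ p → f (false ∷ p) + g (false ∷ p)) + sumSub (λ p → f (true ∷ p) + g (true ∷ p))
    ≡⟨ cong₂ _+_ (sumSub-distrib-+ (f ∘ (false ∷_)) (g ∘ (false ∷_)))
                 (sumSub-distrib-+ (f ∘ (true ∷_)) (g ∘ (true ∷_))) ⟩
  (sumSub (f ∘ (false ∷_)) + sumSub (g ∘ (false ∷_))) + (sumSub (f ∘ (true ∷_)) + sumSub (g ∘ (true ∷_)))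
    ≡⟨ interchange (sumSub (f ∘ (false ∷_))) (sumSub (g ∘ (false ∷_)))
                   (sumSub (f ∘ (true ∷_))) (sumSub (g ∘ (true ∷_))) ⟩
  sumSub f + sumSub g ∎
  where open ≡-Reasoning

sumSub-single : ∀ {n} (f : Subset n → ℤ) q → (∀ p → p ≢ q → f p ≡ 0ℤ) → sumSub f ≡ f q
sumSub-single {zero}  f []      f≗0 = refl
sumSub-single {suc n} f (false ∷ q) f≗0 = begin
  sumSub (f ∘ (false ∷_)) + sumSub (f ∘ (true ∷_)) ≡⟨ cong (sumSub (f ∘ (false ∷_)) +_) (sumSub-zero (f ∘ (true ∷_)) λ p → f≗0 (true ∷ p) λ ()) ⟩
  sumSub (f ∘ (false ∷_)) + 0ℤ                      ≡⟨ ℤP.+-identityʳ _ ⟩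
  sumSub (f ∘ (false ∷_))                           ≡⟨ sumSub-single _ q (λ p p≢q → f≗0 _ (p≢q ∘ ∷-injectiveʳ)) ⟩
  f (false ∷ q)                                     ∎
  where open ≡-Reasoning
sumSub-single {suc n} f (true ∷ q) f≗0 = begin
  sumSub (f ∘ (false ∷_)) + sumSub (f ∘ (true ∷_)) ≡⟨ cong (_+ sumSub (f ∘ (true ∷_))) (sumSub-zero (f ∘ (false ∷_)) λ p → f≗0 (false ∷ p) λ ()) ⟩
  0ℤ + sumSub (f ∘ (true ∷_))                       ≡⟨ ℤP.+-identityˡ _ ⟩
  sumSub (f ∘ (true ∷_))                            ≡⟨ sumSub-single _ q (λ p p≢q → f≗0 _ (p≢q ∘ ∷-injectiveʳ)) ⟩
  f (true ∷ q)                                      ∎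
  where open ≡-Reasoning

_≟ˢ_ : ∀ {n} (p q : Subset n) → Dec (p ≡ q)
_≟ˢ_ = ≡-dec BoolP._≟_

∉⇒lookup≡false : ∀ {n} {x : Fin n} {p : Subset n} → x ∉ p → lookup p x ≡ false
∉⇒lookup≡false {x = x} {p} x∉p with lookup p x in eq
... | true  = ⊥-elim (x∉p (lookup⇒[]= x p eq))
... | false = refl

lookup≡false⇒∉ : ∀ {n} {x : Fin n} {p : Subset n} → lookup p x ≡ false → x ∉ p
lookup≡false⇒∉ eq x∈p = case trans (sym ([]=⇒lookup x∈p)) eq of λ ()

x∈p∪⁅y⁆⁻ : ∀ {n} {x y : Fin n} (p : Subset n) → x ∈ p ∪ ⁅ y ⁆ → x ∈ p ⊎ x ≡ y
x∈p∪⁅y⁆⁻ {y = y} p x∈ = Data.Sum.map₂ (x∈⁅y⁆⇒x≡y y) (x∈p∪q⁻ p ⁅ y ⁆ x∈)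

x∈p⇒x∈p∪⁅y⁆ : ∀ {n} {x y : Fin n} {p : Subset n} → x ∈ p → x ∈ p ∪ ⁅ y ⁆
x∈p⇒x∈p∪⁅y⁆ x∈p = x∈p∪q⁺ (inj₁ x∈p)

y∈p∪⁅y⁆ : ∀ {n} {y : Fin n} {p : Subset n} → y ∈ p ∪ ⁅ y ⁆
y∈p∪⁅y⁆ {y = y} = x∈p∪q⁺ (inj₂ (x∈⁅x⁆ y))

x∉p-x : ∀ {n} (p : Subset n) (x : Fin n) → x ∉ p - x
x∉p-x (_ ∷ p) zero    ()
x∉p-x (_ ∷ p) (suc x) (there x∈) = x∉p-x p x x∈

x∈p-y⁻ : ∀ {n} {x y : Fin n} {p : Subset n} → x ∈ p - y → x ∈ p × x ≢ y
x∈p-y⁻ {x = x} {y} {p} x∈ = p─q⊆p p ⁅ y ⁆ x∈ , λ { refl → x∉p-x p x x∈ }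

x∈p⇒p-x∪⁅x⁆≡p : ∀ {n} {x : Fin n} {p : Subset n} → x ∈ p → (p - x) ∪ ⁅ x ⁆ ≡ p
x∈p⇒p-x∪⁅x⁆≡p {x = x} {p} x∈p = ⊆-antisym ⊆p p⊆
  where
  ⊆p : (p - x) ∪ ⁅ x ⁆ ⊆ p
  ⊆p y∈ with x∈p∪⁅y⁆⁻ (p - x) y∈
  ... | inj₁ y∈p-x = proj₁ (x∈p-y⁻ y∈p-x)
  ... | inj₂ refl  = x∈p
  p⊆ : p ⊆ (p - x) ∪ ⁅ x ⁆
  p⊆ {y} y∈p with y FinP.≟ x
  ... | yes refl = y∈p∪⁅y⁆
  ... | no y≢x   = x∈p⇒x∈p∪⁅y⁆ (x∈p∧x≢y⇒x∈p-y y∈p y≢x)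

p∪⁅x⁆∪⁅y⁆≡p∪⁅y⁆∪⁅x⁆ : ∀ {n} (p : Subset n) x y → (p ∪ ⁅ x ⁆) ∪ ⁅ y ⁆ ≡ (p ∪ ⁅ y ⁆) ∪ ⁅ x ⁆
p∪⁅x⁆∪⁅y⁆≡p∪⁅y⁆∪⁅x⁆ p x y = ⊆-antisym (swap x y) (swap y x)
  where
  swap : ∀ x y → (p ∪ ⁅ x ⁆) ∪ ⁅ y ⁆ ⊆ (p ∪ ⁅ y ⁆) ∪ ⁅ x ⁆
  swap x y z∈ with x∈p∪⁅y⁆⁻ _ z∈
  ... | inj₂ refl = x∈p⇒x∈p∪⁅y⁆ y∈p∪⁅y⁆
  ... | inj₁ z∈′ with x∈p∪⁅y⁆⁻ p z∈′
  ...   | inj₁ z∈p = x∈p⇒x∈p∪⁅y⁆ (x∈p⇒x∈p∪⁅y⁆ z∈p)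
  ...   | inj₂ refl = y∈p∪⁅y⁆

x∈p⇒suc∣p-x∣≡∣p∣ : ∀ {n} {x : Fin n} (p : Subset n) → x ∈ p → suc ∣ p - x ∣ ≡ ∣ p ∣
x∈p⇒suc∣p-x∣≡∣p∣ {x = zero}  (true ∷ p)  here      = cong (suc ∘ ∣_∣) (p─⊥≡p p)
x∈p⇒suc∣p-x∣≡∣p∣ {x = suc x} (true ∷ p)  (there x∈) = cong suc (x∈p⇒suc∣p-x∣≡∣p∣ p x∈)
x∈p⇒suc∣p-x∣≡∣p∣ {x = suc x} (false ∷ p) (there x∈) = x∈p⇒suc∣p-x∣≡∣p∣ p x∈

x∉p⇒∣p∪⁅x⁆∣≡suc∣p∣ : ∀ {n} {x : Fin n} (p : Subset n) → x ∉ p → ∣ p ∪ ⁅ x ⁆ ∣ ≡ suc ∣ p ∣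
x∉p⇒∣p∪⁅x⁆∣≡suc∣p∣ {x = x} p x∉p = begin
  ∣ p ∪ ⁅ x ⁆ ∣                ≡⟨ x∈p⇒suc∣p-x∣≡∣p∣ (p ∪ ⁅ x ⁆) y∈p∪⁅y⁆ ⟨
  suc ∣ (p ∪ ⁅ x ⁆) - x ∣      ≡⟨ cong (suc ∘ ∣_∣) (⊆-antisym ⊆p p⊆) ⟩
  suc ∣ p ∣                     ∎
  where
  open ≡-Reasoning
  ⊆p : (p ∪ ⁅ x ⁆) - x ⊆ p
  ⊆p {y} y∈ with x∈p-y⁻ y∈
  ... | y∈p∪x , y≢x = case x∈p∪⁅y⁆⁻ p y∈p∪x of λ { (inj₁ y∈p) → y∈p ; (inj₂ y≡x) → ⊥-elim (y≢x y≡x) }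
  p⊆ : p ⊆ (p ∪ ⁅ x ⁆) - x
  p⊆ {y} y∈p = x∈p∧x≢y⇒x∈p-y (x∈p⇒x∈p∪⁅y⁆ y∈p) λ { refl → x∉p y∈p }

p⊆q∧∣p∣<∣q∣⇒∃∈q∖p : ∀ {n} {p q : Subset n} → p ⊆ q → ∣ p ∣ ℕ.< ∣ q ∣ → ∃ λ x → x ∈ q × x ∉ p
p⊆q∧∣p∣<∣q∣⇒∃∈q∖p {p = p} {q} p⊆q ∣p∣<∣q∣ with FinP.any? (λ x → x ∈? q ×-dec ¬? (x ∈? p))
... | yes found = found
... | no none = ⊥-elim (ℕP.<⇒≱ ∣p∣<∣q∣ (p⊆q⇒∣p∣≤∣q∣ q⊆p))
  where
  q⊆p : q ⊆ p
  q⊆p {x} x∈q = decidable-stable (x ∈? p) (λ x∉p → none (x , x∈q , x∉p))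

p⊆q∧∣q∣≤∣p∣⇒q⊆p : ∀ {n} {p q : Subset n} → p ⊆ q → ∣ q ∣ ℕ.≤ ∣ p ∣ → q ⊆ p
p⊆q∧∣q∣≤∣p∣⇒q⊆p {p = p} p⊆q ∣q∣≤∣p∣ {x} x∈q =
  decidable-stable (x ∈? p) λ x∉p → ℕP.<⇒≱ (p⊂q⇒∣p∣<∣q∣ (p⊆q , x , x∈q , x∉p)) ∣q∣≤∣p∣

p⊆q∧suc∣p∣≡∣q∣⇒p≡q-x : ∀ {n} {p q : Subset n} → p ⊆ q → suc ∣ p ∣ ≡ ∣ q ∣ →
                       ∃ λ x → x ∈ q × x ∉ p × p ≡ q - x
p⊆q∧suc∣p∣≡∣q∣⇒p≡q-x {p = p} {q} p⊆q size
  with p⊆q∧∣p∣<∣q∣⇒∃∈q∖p p⊆q (ℕP.≤-reflexive size)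
... | x , x∈q , x∉p = x , x∈q , x∉p , ⊆-antisym p⊆q-x (p⊆q∧∣q∣≤∣p∣⇒q⊆p p⊆q-x ∣q-x∣≤∣p∣)
  where
  p⊆q-x : p ⊆ q - x
  p⊆q-x {y} y∈p = x∈p∧x≢y⇒x∈p-y (p⊆q y∈p) λ { refl → x∉p y∈p }
  ∣q-x∣≤∣p∣ : ∣ q - x ∣ ℕ.≤ ∣ p ∣
  ∣q-x∣≤∣p∣ = ℕP.≤-reflexive (ℕP.suc-injective (trans (x∈p⇒suc∣p-x∣≡∣p∣ q x∈q) (sym size)))

-1^n≢0 : ∀ n → -1ℤ ^ n ≢ 0ℤ
-1^n≢0 n eq = case ℤP.i^n≡0⇒i≡0 -1ℤ n eq of λ ()

-1^n*-1^n≡1 : ∀ n → -1ℤ ^ n * -1ℤ ^ n ≡ 1ℤ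
-1^n*-1^n≡1 n = begin
  -1ℤ ^ n * -1ℤ ^ n     ≡⟨ ℤP.^-distribˡ-+-* -1ℤ n n ⟨
  -1ℤ ^ (n ℕ.+ n)       ≡⟨ cong ((-1ℤ ^_) ∘ (n ℕ.+_)) (ℕP.+-identityʳ n) ⟨
  -1ℤ ^ (2 ℕ.* n)       ≡⟨ ℤP.^-*-assoc -1ℤ 2 n ⟨
  1ℤ ^ n                ≡⟨ ℤP.^-zeroˡ n ⟩
  1ℤ                    ∎
  where open ≡-Reasoning

i≡-i⇒i≡0 : ∀ i → i ≡ - i → i ≡ 0ℤ
i≡-i⇒i≡0 (ℤ.+ zero)    _  = refl
i≡-i⇒i≡0 (ℤ.+ suc _)   ()
i≡-i⇒i≡0 ℤ.-[1+ _ ]     ()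

module ChainComplex {n : ℕ} (P : FinPoset n) where
  open FinPoset P
  open Poset P
  open IsStrictPartialOrder isSPO using (asym)

  Chain : Subset n → Set
  Chain σ = ∀ x y → x ∈ σ → y ∈ σ → x ≢ y → (x < y) ⊎ (y < x)

  sgn : Subset n → Fin n → ℤ
  sgn σ v = -1ℤ ^ position σ v

  ∂-term : ZChain → Subset n → Fin n → ℤ
  ∂-term c σ v = if lookup σ v then 0ℤ else sgn σ v * c (σ ∪ ⁅ v ⁆)

  ∂-term-∈ : ∀ c {σ v} → v ∈ σ → ∂-term c σ v ≡ 0ℤ
  ∂-term-∈ c v∈σ rewrite []=⇒lookup v∈σ = refl

  ∂-term-∉ : ∀ c {σ v} → v ∉ σ → ∂-term c σ v ≡ sgn σ v * c (σ ∪ ⁅ v ⁆)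
  ∂-term-∉ c v∉σ rewrite ∉⇒lookup≡false v∉σ = refl

  _+⟨_⟩_ : ZChain → ℤ → ZChain → ZChain
  (f +⟨ k ⟩ g) σ = f σ + k * g σ

  +⟨⟩-nonzero : ∀ f k g σ → (f +⟨ k ⟩ g) σ ≢ 0ℤ → f σ ≢ 0ℤ ⊎ g σ ≢ 0ℤ
  +⟨⟩-nonzero f k g σ ≢0 with f σ ≟ 0ℤ | g σ ≟ 0ℤ
  ... | no f≢0 | _      = inj₁ f≢0
  ... | yes _  | no g≢0 = inj₂ g≢0
  ... | yes f≡0 | yes g≡0 = ⊥-elim (≢0 (trans (cong₂ (λ a b → a + k * b) f≡0 g≡0)
                                                     (trans (ℤP.+-identityˡ _) (ℤP.*-zeroʳ k))))

  ∂-+⟨⟩ : ∀ f k g τ → ∂ (f +⟨ k ⟩ g) τ ≡ ∂ f τ + k * ∂ g τ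
  ∂-+⟨⟩ f k g τ = begin
    sumFin (∂-term (f +⟨ k ⟩ g) τ)                          ≡⟨ sumFin-cong termwise ⟩
    sumFin (λ v → ∂-term f τ v + k * ∂-term g τ v)          ≡⟨ sumFin-distrib-+ (∂-term f τ) _ ⟩
    ∂ f τ + sumFin (λ v → k * ∂-term g τ v)                 ≡⟨ cong (∂ f τ +_) (*-distribˡ-sumFin k (∂-term g τ)) ⟨
    ∂ f τ + k * ∂ g τ                                       ∎
    where
    open ≡-Reasoning
    termwise : ∀ v → ∂-term (f +⟨ k ⟩ g) τ v ≡ ∂-term f τ v + k * ∂-term g τ v
    termwise v with lookup τ v
    ... | true  = sym (trans (ℤP.+-identityˡ (k * 0ℤ)) (ℤP.*-zeroʳ k))
    ... | false = distrib (sgn τ v) (f (τ ∪ ⁅ v ⁆)) k (g (τ ∪ ⁅ v ⁆))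
      where
      distrib : ∀ s a k b → s * (a + k * b) ≡ s * a + k * (s * b)
      distrib = solve-∀

  +⟨⟩-Cycle : ∀ {Q s f g} k → Cycle Q s f → Cycle Q s g → Cycle Q s (f +⟨ k ⟩ g)
  +⟨⟩-Cycle {Q} {s} {f} {g} k (f-supp , ∂f≡0) (g-supp , ∂g≡0) = supp , ∂≡0
    where
    supp : SupportedOn Q s (f +⟨ k ⟩ g)
    supp σ ≢0 = case +⟨⟩-nonzero f k g σ ≢0 of λ { (inj₁ f≢0) → f-supp σ f≢0 ; (inj₂ g≢0) → g-supp σ g≢0 }
    ∂≡0 : ∀ σ → ∂ (f +⟨ k ⟩ g) σ ≡ 0ℤ
    ∂≡0 σ = begin
      ∂ (f +⟨ k ⟩ g) σ     ≡⟨ ∂-+⟨⟩ f k g σ ⟩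
      ∂ f σ + k * ∂ g σ    ≡⟨ cong₂ (λ a b → a + k * b) (∂f≡0 σ) (∂g≡0 σ) ⟩
      0ℤ + k * 0ℤ          ≡⟨ ℤP.+-identityˡ (k * 0ℤ) ⟩
      k * 0ℤ               ≡⟨ ℤP.*-zeroʳ k ⟩
      0ℤ                   ∎
      where open ≡-Reasoning

  ∂-zero : ∀ c → (∀ σ → c σ ≡ 0ℤ) → ∀ τ → ∂ c τ ≡ 0ℤ
  ∂-zero c c≗0 τ = sumFin-zero (∂-term c τ) termwise
    where
    termwise : ∀ v → ∂-term c τ v ≡ 0ℤ
    termwise v with lookup τ v
    ... | true  = refl
    ... | false = trans (cong (sgn τ v *_) (c≗0 _)) (ℤP.*-zeroʳ (sgn τ v))

  ∂-nonzero : ∀ c τ → ∂ c τ ≢ 0ℤ → ∃ λ v → v ∉ τ × c (τ ∪ ⁅ v ⁆) ≢ 0ℤ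
  ∂-nonzero c τ ≢0 with sumFin-nonzero (∂-term c τ) ≢0
  ... | v , term≢0 with lookup τ v in eq
  ... | true  = ⊥-elim (term≢0 refl)
  ... | false = v , lookup≡false⇒∉ eq , λ c≡0 → term≢0 (trans (cong (sgn τ v *_) c≡0) (ℤP.*-zeroʳ (sgn τ v)))

  ∂-concentrated : ∀ c τ x → x ∉ τ → (∀ w → w ∉ τ → w ≢ x → c (τ ∪ ⁅ w ⁆) ≡ 0ℤ) →
                   ∂ c τ ≡ sgn τ x * c (τ ∪ ⁅ x ⁆)
  ∂-concentrated c τ x x∉τ others = trans (sumFin-single (∂-term c τ) x termwise) (∂-term-∉ c x∉τ)
    where
    termwise : ∀ w → w ≢ x → ∂-term c τ w ≡ 0ℤ
    termwise w w≢x with w ∈? τ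
    ... | yes w∈τ = ∂-term-∈ c w∈τ
    ... | no w∉τ  = trans (∂-term-∉ c w∉τ) (trans (cong (sgn τ w *_) (others w w∉τ w≢x)) (ℤP.*-zeroʳ (sgn τ w)))

  ltℤ : Fin n → Fin n → ℤ
  ltℤ u v = if ⌊ u <? v ⌋ then 1ℤ else 0ℤ

  -- position σ v is ∣ countBelow σ v ∣ by definition; the count is nonnegative, so ∣_∣ can be dropped.
  countBelow : Subset n → Fin n → ℤ
  countBelow σ v = sumFin (λ u → if lookup σ u then ltℤ u v else 0ℤ)

  countBelow≡+position : ∀ σ v → countBelow σ v ≡ ℤ.+ position σ v
  countBelow≡+position σ v = sym (ℤP.0≤i⇒+∣i∣≡i (sumFin-nonneg _ termwise))
    where
    sumFin-nonneg : ∀ {m} (f : Fin m → ℤ) → (∀ i → 0ℤ ℤ.≤ f i) → 0ℤ ℤ.≤ sumFin f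
    sumFin-nonneg {zero}  f f≥0 = ℤP.≤-refl
    sumFin-nonneg {suc m} f f≥0 = ℤP.+-mono-≤ (f≥0 zero) (sumFin-nonneg (f ∘ suc) (f≥0 ∘ suc))
    termwise : ∀ u → 0ℤ ℤ.≤ (if lookup σ u then ltℤ u v else 0ℤ)
    termwise u with lookup σ u | ⌊ u <? v ⌋
    ... | true  | true  = ℤ.+≤+ ℕ.z≤n
    ... | true  | false = ℤP.≤-refl
    ... | false | _     = ℤP.≤-refl

  countBelow-∪ : ∀ σ w v → w ∉ σ → countBelow (σ ∪ ⁅ w ⁆) v ≡ countBelow σ v + ltℤ w v
  countBelow-∪ σ w v w∉σ = begin
    countBelow (σ ∪ ⁅ w ⁆) v                  ≡⟨ sumFin-cong split ⟩
    sumFin (λ u → term σ u + term ⁅ w ⁆ u)    ≡⟨ sumFin-distrib-+ (term σ) (term ⁅ w ⁆) ⟩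
    countBelow σ v + sumFin (term ⁅ w ⁆)      ≡⟨ cong (countBelow σ v +_) (sumFin-single (term ⁅ w ⁆) w only-w) ⟩
    countBelow σ v + term ⁅ w ⁆ w             ≡⟨ cong (λ b → countBelow σ v + (if b then ltℤ w v else 0ℤ)) ([]=⇒lookup (x∈⁅x⁆ w)) ⟩
    countBelow σ v + ltℤ w v                  ∎
    where
    open ≡-Reasoning
    term : Subset n → Fin n → ℤ
    term τ u = if lookup τ u then ltℤ u v else 0ℤ
    only-w : ∀ u → u ≢ w → term ⁅ w ⁆ u ≡ 0ℤ
    only-w u u≢w rewrite ∉⇒lookup≡false (x≢y⇒x∉⁅y⁆ u≢w) = refl
    split : ∀ u → term (σ ∪ ⁅ w ⁆) u ≡ term σ u + term ⁅ w ⁆ u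
    split u rewrite lookup-zipWith _∨_ u σ ⁅ w ⁆ with u FinP.≟ w
    ... | yes refl rewrite ∉⇒lookup≡false w∉σ | []=⇒lookup (x∈⁅x⁆ w) = sym (ℤP.+-identityˡ _)
    ... | no u≢w rewrite ∉⇒lookup≡false (x≢y⇒x∉⁅y⁆ u≢w) with lookup σ u
    ...   | true  = sym (ℤP.+-identityʳ _)
    ...   | false = refl

  sgn-∪-below : ∀ σ w v → w ∉ σ → w < v → sgn (σ ∪ ⁅ w ⁆) v ≡ -1ℤ * sgn σ v
  sgn-∪-below σ w v w∉σ w<v = cong (-1ℤ ^_) (ℤP.+-injective (begin
    ℤ.+ position (σ ∪ ⁅ w ⁆) v   ≡⟨ countBelow≡+position (σ ∪ ⁅ w ⁆) v ⟨
    countBelow (σ ∪ ⁅ w ⁆) v     ≡⟨ countBelow-∪ σ w v w∉σ ⟩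
    countBelow σ v + ltℤ w v     ≡⟨ cong₂ _+_ (countBelow≡+position σ v) lt≡1 ⟩
    ℤ.+ (position σ v ℕ.+ 1)     ≡⟨ cong ℤ.+_ (ℕP.+-comm (position σ v) 1) ⟩
    ℤ.+ suc (position σ v)       ∎))
    where
    open ≡-Reasoning
    lt≡1 : ltℤ w v ≡ 1ℤ
    lt≡1 with w <? v
    ... | yes _   = refl
    ... | no w≮v  = ⊥-elim (w≮v w<v)

  sgn-∪-above : ∀ σ w v → w ∉ σ → ¬ w < v → sgn (σ ∪ ⁅ w ⁆) v ≡ sgn σ v
  sgn-∪-above σ w v w∉σ w≮v = cong (-1ℤ ^_) (ℤP.+-injective (begin
    ℤ.+ position (σ ∪ ⁅ w ⁆) v   ≡⟨ countBelow≡+position (σ ∪ ⁅ w ⁆) v ⟨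
    countBelow (σ ∪ ⁅ w ⁆) v     ≡⟨ countBelow-∪ σ w v w∉σ ⟩
    countBelow σ v + ltℤ w v     ≡⟨ cong₂ _+_ (countBelow≡+position σ v) lt≡0 ⟩
    ℤ.+ position σ v + 0ℤ        ≡⟨ ℤP.+-identityʳ _ ⟩
    ℤ.+ position σ v             ∎))
    where
    open ≡-Reasoning
    lt≡0 : ltℤ w v ≡ 0ℤ
    lt≡0 with w <? v
    ... | yes w<v = ⊥-elim (w≮v w<v)
    ... | no _    = refl

  module DoubleBoundary (c : ZChain) (σ : Subset n) where
    open ≡-Reasoning

    T : Fin n → Fin n → ℤ
    T w v = if lookup σ w then 0ℤ else sgn σ w * ∂-term c (σ ∪ ⁅ w ⁆) v

    T-outside : ∀ {w v} → w ∉ σ → T w v ≡ sgn σ w * ∂-term c (σ ∪ ⁅ w ⁆) v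
    T-outside w∉σ rewrite ∉⇒lookup≡false w∉σ = refl

    T-∉ : ∀ {w v} → w ∉ σ → v ∉ σ → w ≢ v →
          T w v ≡ sgn σ w * (sgn (σ ∪ ⁅ w ⁆) v * c ((σ ∪ ⁅ w ⁆) ∪ ⁅ v ⁆))
    T-∉ {w} {v} w∉σ v∉σ w≢v = trans (T-outside w∉σ) (cong (sgn σ w *_) (∂-term-∉ c v∉σ∪w))
      where
      v∉σ∪w : v ∉ σ ∪ ⁅ w ⁆
      v∉σ∪w v∈ = case x∈p∪⁅y⁆⁻ σ v∈ of λ { (inj₁ v∈σ) → v∉σ v∈σ ; (inj₂ refl) → w≢v refl }

    T-degenerate : ∀ {w v} → w ∈ σ ⊎ v ∈ σ ⊎ w ≡ v → T w v ≡ 0ℤ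
    T-degenerate {w} {v} deg with w ∈? σ
    ... | yes w∈σ rewrite []=⇒lookup w∈σ = refl
    ... | no w∉σ =
      trans (T-outside w∉σ) (trans (cong (sgn σ w *_) (∂-term-∈ c v∈σ∪w)) (ℤP.*-zeroʳ (sgn σ w)))
      where
      v∈σ∪w : v ∈ σ ∪ ⁅ w ⁆
      v∈σ∪w = case deg of λ
        { (inj₁ w∈σ)        → ⊥-elim (w∉σ w∈σ)
        ; (inj₂ (inj₁ v∈σ)) → x∈p⇒x∈p∪⁅y⁆ v∈σ
        ; (inj₂ (inj₂ refl)) → y∈p∪⁅y⁆ }

    ∂-term-∂≡sumFin-T : ∀ w → ∂-term (∂ c) σ w ≡ sumFin (T w)
    ∂-term-∂≡sumFin-T w with w ∈? σ
    ... | yes w∈σ = trans (∂-term-∈ (∂ c) w∈σ) (sym (sumFin-zero (T w) (λ v → T-degenerate (inj₁ w∈σ))))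
    ... | no w∉σ  = begin
      ∂-term (∂ c) σ w                                   ≡⟨ ∂-term-∉ (∂ c) w∉σ ⟩
      sgn σ w * ∂ c (σ ∪ ⁅ w ⁆)                          ≡⟨ *-distribˡ-sumFin (sgn σ w) (∂-term c (σ ∪ ⁅ w ⁆)) ⟩
      sumFin (λ v → sgn σ w * ∂-term c (σ ∪ ⁅ w ⁆) v)    ≡⟨ sumFin-cong (λ v → T-outside {w} {v} w∉σ) ⟨
      sumFin (T w)                                       ∎

    T-vanishing-face : ∀ {w v} → w ∉ σ → v ∉ σ → w ≢ v → c ((σ ∪ ⁅ w ⁆) ∪ ⁅ v ⁆) ≡ 0ℤ → T w v ≡ 0ℤ
    T-vanishing-face {w} {v} w∉σ v∉σ w≢v c≡0 = begin
      T w v                                 ≡⟨ T-∉ w∉σ v∉σ w≢v ⟩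
      sgn σ w * (sgn (σ ∪ ⁅ w ⁆) v * c _)   ≡⟨ cong (λ x → sgn σ w * (sgn (σ ∪ ⁅ w ⁆) v * x)) c≡0 ⟩
      sgn σ w * (sgn (σ ∪ ⁅ w ⁆) v * 0ℤ)    ≡⟨ cong (sgn σ w *_) (ℤP.*-zeroʳ (sgn (σ ∪ ⁅ w ⁆) v)) ⟩
      sgn σ w * 0ℤ                          ≡⟨ ℤP.*-zeroʳ (sgn σ w) ⟩
      0ℤ                                    ∎

    -- Orienting faces by the order makes the two routes from σ ∪ {w, v} down to σ carry opposite signs.
    T-antisym-< : ∀ {w v} → w ∉ σ → v ∉ σ → w < v → T w v ≡ - T v w
    T-antisym-< {w} {v} w∉σ v∉σ w<v = begin
      T w v                                             ≡⟨ T-∉ w∉σ v∉σ w≢v ⟩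
      sgn σ w * (sgn (σ ∪ ⁅ w ⁆) v * c ((σ ∪ ⁅ w ⁆) ∪ ⁅ v ⁆))
        ≡⟨ cong₂ (λ s τ → sgn σ w * (s * c τ)) (sgn-∪-below σ w v w∉σ w<v) (p∪⁅x⁆∪⁅y⁆≡p∪⁅y⁆∪⁅x⁆ σ w v) ⟩
      sgn σ w * (-1ℤ * sgn σ v * c ((σ ∪ ⁅ v ⁆) ∪ ⁅ w ⁆)) ≡⟨ swap (sgn σ w) (sgn σ v) _ ⟩
      - (sgn σ v * (sgn σ w * c ((σ ∪ ⁅ v ⁆) ∪ ⁅ w ⁆)))  ≡⟨ cong (λ s → - (sgn σ v * (s * _))) (sgn-∪-above σ v w v∉σ (asym w<v)) ⟨
      - (sgn σ v * (sgn (σ ∪ ⁅ v ⁆) w * c ((σ ∪ ⁅ v ⁆) ∪ ⁅ w ⁆))) ≡⟨ cong -_ (T-∉ v∉σ w∉σ (w≢v ∘ sym)) ⟨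
      - T v w                                           ∎
      where
      w≢v : w ≢ v
      w≢v refl = asym w<v w<v
      swap : ∀ a b x → a * (-1ℤ * b * x) ≡ - (b * (a * x))
      swap = solve-∀

    T-antisym : (∀ τ → c τ ≢ 0ℤ → Chain τ) → ∀ w v → T w v ≡ - T v w
    T-antisym chains w v with w ∈? σ | v ∈? σ | w FinP.≟ v
    ... | yes w∈σ | _ | _ = trans (T-degenerate (inj₁ w∈σ)) (cong -_ (sym (T-degenerate (inj₂ (inj₁ w∈σ)))))
    ... | _ | yes v∈σ | _ = trans (T-degenerate (inj₂ (inj₁ v∈σ))) (cong -_ (sym (T-degenerate (inj₁ v∈σ))))
    ... | _ | _ | yes refl = trans (T-degenerate (inj₂ (inj₂ refl))) (cong -_ (sym (T-degenerate (inj₂ (inj₂ refl)))))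
    ... | no w∉σ | no v∉σ | no w≢v with c ((σ ∪ ⁅ w ⁆) ∪ ⁅ v ⁆) ≟ 0ℤ
    ...   | yes c≡0 = trans (T-vanishing-face w∉σ v∉σ w≢v c≡0)
                            (cong -_ (sym (T-vanishing-face v∉σ w∉σ (w≢v ∘ sym) c′≡0)))
      where
      c′≡0 : c ((σ ∪ ⁅ v ⁆) ∪ ⁅ w ⁆) ≡ 0ℤ
      c′≡0 = trans (cong c (p∪⁅x⁆∪⁅y⁆≡p∪⁅y⁆∪⁅x⁆ σ v w)) c≡0
    ...   | no c≢0 with chains _ c≢0 w v (x∈p⇒x∈p∪⁅y⁆ y∈p∪⁅y⁆) y∈p∪⁅y⁆ w≢v
    ...     | inj₁ w<v = T-antisym-< w∉σ v∉σ w<v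
    ...     | inj₂ v<w = trans (sym (ℤP.neg-involutive (T w v))) (cong -_ (sym (T-antisym-< v∉σ w∉σ v<w)))

  ∂∂≡0 : ∀ c → (∀ τ → c τ ≢ 0ℤ → Chain τ) → ∀ σ → ∂ (∂ c) σ ≡ 0ℤ
  ∂∂≡0 c chains σ = i≡-i⇒i≡0 (∂ (∂ c) σ) (begin
    ∂ (∂ c) σ                                 ≡⟨ sumFin-cong ∂-term-∂≡sumFin-T ⟩
    sumFin (λ w → sumFin (T w))               ≡⟨ sumFin-cong (λ w → sumFin-cong (T-antisym chains w)) ⟩
    sumFin (λ w → sumFin (λ v → - T v w))     ≡⟨ sumFin-cong (λ w → neg-distrib-sumFin (λ v → T v w)) ⟨
    sumFin (λ w → - sumFin (λ v → T v w))     ≡⟨ neg-distrib-sumFin (λ w → sumFin (λ v → T v w)) ⟨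
    - sumFin (λ w → sumFin (λ v → T v w))     ≡⟨ cong -_ (sumFin-comm T) ⟨
    - sumFin (λ w → sumFin (T w))             ≡⟨ cong -_ (sumFin-cong ∂-term-∂≡sumFin-T) ⟨
    - ∂ (∂ c) σ                               ∎)
    where
    open ≡-Reasoning
    open DoubleBoundary c σ

  ∂≡0⇒lone-coface≡0 : ∀ c τ x → ∂ c τ ≡ 0ℤ → x ∉ τ →
                      (∀ w → w ∉ τ → w ≢ x → c (τ ∪ ⁅ w ⁆) ≡ 0ℤ) → c (τ ∪ ⁅ x ⁆) ≡ 0ℤ
  ∂≡0⇒lone-coface≡0 c τ x ∂c≡0 x∉τ others
    with ℤP.i*j≡0⇒i≡0∨j≡0 (sgn τ x) (trans (sym (∂-concentrated c τ x x∉τ others)) ∂c≡0)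
  ... | inj₁ sgn≡0 = ⊥-elim (-1^n≢0 (position τ x) sgn≡0)
  ... | inj₂ c≡0   = c≡0

  ∂≡0⇒another-coface : ∀ c G x → ∂ c (G - x) ≡ 0ℤ → x ∈ G → c G ≢ 0ℤ →
                       ∃ λ w → w ≢ x × w ∉ G - x × c ((G - x) ∪ ⁅ w ⁆) ≢ 0ℤ
  ∂≡0⇒another-coface c G x ∂c≡0 x∈G cG≢0
    with FinP.any? (λ w → ¬? (w FinP.≟ x) ×-dec ¬? (w ∈? (G - x)) ×-dec ¬? (c ((G - x) ∪ ⁅ w ⁆) ≟ 0ℤ))
  ... | yes found = found
  ... | no none = ⊥-elim (cG≢0 (subst (λ F → c F ≡ 0ℤ) (x∈p⇒p-x∪⁅x⁆≡p x∈G)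
          (∂≡0⇒lone-coface≡0 c (G - x) x ∂c≡0 (x∉p-x G x) λ w w∉ w≢x →
             decidable-stable (c _ ≟ 0ℤ) (λ c≢0 → none (w , w≢x , w∉ , c≢0)))))

  elementary : Subset n → ZChain
  elementary F σ = if ⌊ σ ≟ˢ F ⌋ then 1ℤ else 0ℤ

  elementary-self : ∀ F → elementary F F ≡ 1ℤ
  elementary-self F with F ≟ˢ F
  ... | yes _   = refl
  ... | no F≢F  = ⊥-elim (F≢F refl)

  elementary-other : ∀ F σ → σ ≢ F → elementary F σ ≡ 0ℤ
  elementary-other F σ σ≢F with σ ≟ˢ F
  ... | yes σ≡F = ⊥-elim (σ≢F σ≡F)
  ... | no _    = refl

  elementary-nonzero : ∀ F σ → elementary F σ ≢ 0ℤ → σ ≡ F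
  elementary-nonzero F σ ≢0 with σ ≟ˢ F
  ... | yes σ≡F = σ≡F
  ... | no _    = ⊥-elim (≢0 refl)

  ∂-elementary-nonzero : ∀ F τ → ∂ (elementary F) τ ≢ 0ℤ → ∃ λ v → v ∉ τ × τ ∪ ⁅ v ⁆ ≡ F
  ∂-elementary-nonzero F τ ≢0 with ∂-nonzero (elementary F) τ ≢0
  ... | v , v∉τ , e≢0 = v , v∉τ , elementary-nonzero F _ e≢0

  ∂-elementary-facet : ∀ F x → x ∈ F → ∂ (elementary F) (F - x) ≡ sgn (F - x) x
  ∂-elementary-facet F x x∈F = begin
    ∂ (elementary F) (F - x)                        ≡⟨ ∂-concentrated (elementary F) (F - x) x (x∉p-x F x) others ⟩
    sgn (F - x) x * elementary F ((F - x) ∪ ⁅ x ⁆)  ≡⟨ cong (λ σ → sgn (F - x) x * elementary F σ) (x∈p⇒p-x∪⁅x⁆≡p x∈F) ⟩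
    sgn (F - x) x * elementary F F                  ≡⟨ cong (sgn (F - x) x *_) (elementary-self F) ⟩
    sgn (F - x) x * 1ℤ                              ≡⟨ ℤP.*-identityʳ _ ⟩
    sgn (F - x) x                                   ∎
    where
    open ≡-Reasoning
    others : ∀ w → w ∉ F - x → w ≢ x → elementary F ((F - x) ∪ ⁅ w ⁆) ≡ 0ℤ
    others w w∉ w≢x = elementary-other F _ λ eq → w∉ (x∈p∧x≢y⇒x∈p-y (subst (w ∈_) eq y∈p∪⁅y⁆) w≢x)

  SupportedOn-too-large≡0 : ∀ Q s d → SupportedOn Q s d → (∀ σ → ChainIn Q σ → ∣ σ ∣ ℕ.< s) →
                            ∀ σ → d σ ≡ 0ℤ
  SupportedOn-too-large≡0 Q s d supp small σ = decidable-stable (d σ ≟ 0ℤ) λ d≢0 →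
    let (σ∈Q , ∣σ∣≡s) = supp σ d≢0 in ℕP.<-irrefl ∣σ∣≡s (small σ σ∈Q)

  combination-distrib-+ : ∀ a b ρ σ → combination (λ m c → a m c + b m c) ρ σ ≡
                                       combination a ρ σ + combination b ρ σ
  combination-distrib-+ a b ρ σ = begin
    sumFin (λ m → sumSub (λ c → (a m c + b m c) * ρ m c σ))
      ≡⟨ sumFin-cong (λ m → sumSub-cong (λ c → ℤP.*-distribʳ-+ (ρ m c σ) (a m c) (b m c))) ⟩
    sumFin (λ m → sumSub (λ c → a m c * ρ m c σ + b m c * ρ m c σ))
      ≡⟨ sumFin-cong (λ m → sumSub-distrib-+ (λ c → a m c * ρ m c σ) (λ c → b m c * ρ m c σ)) ⟩
    sumFin (λ m → sumSub (λ c → a m c * ρ m c σ) + sumSub (λ c → b m c * ρ m c σ))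
      ≡⟨ sumFin-distrib-+ (λ m → sumSub (λ c → a m c * ρ m c σ)) (λ m → sumSub (λ c → b m c * ρ m c σ)) ⟩
    combination a ρ σ + combination b ρ σ ∎
    where open ≡-Reasoning

  combination-concentrated : ∀ a ρ σ m c → (∀ m′ c′ → ¬ (m′ ≡ m × c′ ≡ c) → a m′ c′ * ρ m′ c′ σ ≡ 0ℤ) →
                             combination a ρ σ ≡ a m c * ρ m c σ
  combination-concentrated a ρ σ m c others =
    trans (sumFin-single _ m λ m′ m′≢m → sumSub-zero _ λ c′ → others m′ c′ (m′≢m ∘ proj₁))
          (sumSub-single _ c λ c′ c′≢c → others m c′ (c′≢c ∘ proj₂))

  unitCoeff : Fin n → Subset n → ℤ → Fin n → Subset n → ℤ
  unitCoeff m c k m′ c′ = if ⌊ m′ FinP.≟ m ⌋ ∧ ⌊ c′ ≟ˢ c ⌋ then k else 0ℤ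

  unitCoeff-self : ∀ m c k → unitCoeff m c k m c ≡ k
  unitCoeff-self m c k with m FinP.≟ m | c ≟ˢ c
  ... | yes _   | yes _   = refl
  ... | no m≢m  | _       = ⊥-elim (m≢m refl)
  ... | yes _   | no c≢c  = ⊥-elim (c≢c refl)

  unitCoeff-nonzero : ∀ m c k m′ c′ → unitCoeff m c k m′ c′ ≢ 0ℤ → m′ ≡ m × c′ ≡ c
  unitCoeff-nonzero m c k m′ c′ ≢0 with m′ FinP.≟ m | c′ ≟ˢ c
  ... | yes m′≡m | yes c′≡c = m′≡m , c′≡c
  ... | yes _    | no _     = ⊥-elim (≢0 refl)
  ... | no _     | _        = ⊥-elim (≢0 refl)

  combination-unitCoeff : ∀ m c k ρ σ → combination (unitCoeff m c k) ρ σ ≡ k * ρ m c σ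
  combination-unitCoeff m c k ρ σ = begin
    combination (unitCoeff m c k) ρ σ     ≡⟨ combination-concentrated (unitCoeff m c k) ρ σ m c others ⟩
    unitCoeff m c k m c * ρ m c σ         ≡⟨ cong (_* ρ m c σ) (unitCoeff-self m c k) ⟩
    k * ρ m c σ                           ∎
    where
    open ≡-Reasoning
    others : ∀ m′ c′ → ¬ (m′ ≡ m × c′ ≡ c) → unitCoeff m c k m′ c′ * ρ m′ c′ σ ≡ 0ℤ
    others m′ c′ ≢mc = cong (_* ρ m′ c′ σ)
      (decidable-stable (unitCoeff m c k m′ c′ ≟ 0ℤ) (≢mc ∘ unitCoeff-nonzero m c k m′ c′))

module MaximalChains {n : ℕ} (P : FinPoset n) where
  open FinPoset P
  open Poset P
  open ChainComplex P using (Chain; ∂≡0⇒another-coface)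
  open IsStrictPartialOrder isSPO using (irrefl; asym) renaming (trans to <-trans)

  chain? : ∀ σ → Dec (Chain σ)
  chain? σ = FinP.all? λ x → FinP.all? λ y →
    x ∈? σ →-dec (y ∈? σ →-dec (¬? (x FinP.≟ y) →-dec (x <? y ⊎-dec y <? x)))

  isMaximal? : ∀ m → Dec (IsMaximal m)
  isMaximal? m = FinP.all? λ y → ¬? (m <? y)

  maximal-element : ∀ (S : Fin n → Set) → (∀ x → Dec (S x)) → ∀ x → S x →
                    ∃ λ t → S t × ∀ y → S y → ¬ t < y
  maximal-element S S? x Sx with scan (allFin n)
    where
    scan : ∀ L → ∃ λ t → S t × ∀ y → y List.∈ L → S y → ¬ t < y
    scan []      = x , Sx , λ _ ()
    scan (y ∷ L) with scan L
    ... | t , St , top with S? y ×-dec t <? y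
    ...   | yes (Sy , t<y) = y , Sy , λ
      { z (Any.here refl) _         → irrefl refl
      ; z (Any.there z∈L) Sz y<z → top z z∈L Sz (<-trans t<y y<z) }
    ...   | no ¬up = t , St , λ
      { z (Any.here refl) Sz t<z → ¬up (Sz , t<z)
      ; z (Any.there z∈L)        → top z z∈L }
  ... | t , St , top = t , St , λ y → top y (∈-allFin y)

  maxChain-top : ∀ {τ x} → MaxChainIn whole τ → x ∈ τ → ∃ λ t → t ∈ τ × IsMaximal t
  maxChain-top {τ} {x} ((_ , chain) , maximal) x∈τ with maximal-element (_∈ τ) (_∈? τ) x x∈τ
  ... | t , t∈τ , top = t , t∈τ , λ y t<y → maximal y (y∉τ t<y) ((λ _ _ → tt) , chain∪y t<y)
    where
    y∉τ : ∀ {y} → t < y → y ∉ τ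
    y∉τ t<y y∈τ = top _ y∈τ t<y
    below-t : ∀ {z} → z ∈ τ → z ≢ t → z < t
    below-t {z} z∈τ z≢t with chain z t z∈τ t∈τ z≢t
    ... | inj₁ z<t = z<t
    ... | inj₂ t<z = ⊥-elim (top z z∈τ t<z)
    below-y : ∀ {y z} → t < y → z ∈ τ → z < y
    below-y {z = z} t<y z∈τ with z FinP.≟ t
    ... | yes refl = t<y
    ... | no z≢t   = <-trans (below-t z∈τ z≢t) t<y
    chain∪y : ∀ {y} → t < y → Chain (τ ∪ ⁅ y ⁆)
    chain∪y t<y a b a∈ b∈ a≢b with x∈p∪⁅y⁆⁻ τ a∈ | x∈p∪⁅y⁆⁻ τ b∈
    ... | inj₁ a∈τ | inj₁ b∈τ = chain a b a∈τ b∈τ a≢b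
    ... | inj₁ a∈τ | inj₂ refl = inj₁ (below-y t<y a∈τ)
    ... | inj₂ refl | inj₁ b∈τ = inj₂ (below-y t<y b∈τ)
    ... | inj₂ refl | inj₂ refl = ⊥-elim (a≢b refl)

  extend-to-maxChain : ∀ {σ} → Chain σ → ∃ λ τ → σ ⊆ τ × MaxChainIn whole τ
  extend-to-maxChain {σ} = extend n σ (ℕP.m≤m+n n ∣ σ ∣)
    where
    -- Since n ≤ k + ∣ σ ∣, σ is all of Fin n when the fuel k runs out.
    extend : ∀ k σ → n ℕ.≤ k ℕ.+ ∣ σ ∣ → Chain σ → ∃ λ τ → σ ⊆ τ × MaxChainIn whole τ
    extend k σ n≤ chain with FinP.any? (λ v → ¬? (v ∈? σ) ×-dec chain? (σ ∪ ⁅ v ⁆))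
    ... | no none = σ , ⊆-refl , ((λ _ _ → tt) , chain) , λ v v∉σ (_ , chain′) → none (v , v∉σ , chain′)
    ... | yes (v , v∉σ , chain′) with k
    ...   | zero = ⊥-elim (ℕP.<⇒≱ (ℕP.≤-trans (ℕP.≤-reflexive (sym (x∉p⇒∣p∪⁅x⁆∣≡suc∣p∣ σ v∉σ)))
                                                  (∣p∣≤n (σ ∪ ⁅ v ⁆))) n≤)
    ...   | suc k with extend k (σ ∪ ⁅ v ⁆) n≤′ chain′
      where
      n≤′ : n ℕ.≤ k ℕ.+ ∣ σ ∪ ⁅ v ⁆ ∣
      n≤′ = subst (λ s → n ℕ.≤ k ℕ.+ s) (sym (x∉p⇒∣p∪⁅x⁆∣≡suc∣p∣ σ v∉σ))
                  (subst (n ℕ.≤_) (sym (ℕP.+-suc k ∣ σ ∣)) n≤)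
    ...     | τ , σ∪v⊆τ , max = τ , σ∪v⊆τ ∘ x∈p⇒x∈p∪⁅y⁆ , max

  ChainIn-⊆ : ∀ {Q σ τ} → σ ⊆ τ → ChainIn Q τ → ChainIn Q σ
  ChainIn-⊆ σ⊆τ (τ∈Q , chain) = (λ x → τ∈Q x ∘ σ⊆τ) , λ x y x∈ y∈ → chain x y (σ⊆τ x∈) (σ⊆τ y∈)

  MaxChainIn-⊆ : ∀ {Q σ τ} → MaxChainIn Q σ → ChainIn Q τ → σ ⊆ τ → σ ≡ τ
  MaxChainIn-⊆ {σ = σ} {τ} (_ , maximal) τ-chain σ⊆τ = ⊆-antisym σ⊆τ λ {v} v∈τ →
    decidable-stable (v ∈? σ) λ v∉σ → maximal v v∉σ (ChainIn-⊆ (σ∪v⊆τ v∈τ) τ-chain)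
    where
    σ∪v⊆τ : ∀ {v} → v ∈ τ → σ ∪ ⁅ v ⁆ ⊆ τ
    σ∪v⊆τ v∈τ x∈ = case x∈p∪⁅y⁆⁻ σ x∈ of λ { (inj₁ x∈σ) → σ⊆τ x∈σ ; (inj₂ refl) → v∈τ }

  ChainIn-of-maximum-size : ∀ {Q s σ} → (∀ τ → ChainIn Q τ → ∣ τ ∣ ℕ.≤ s) →
                            ChainIn Q σ → ∣ σ ∣ ≡ s → MaxChainIn Q σ
  ChainIn-of-maximum-size {Q} {s} {σ} bound σ-chain ∣σ∣≡s = σ-chain , λ v v∉σ σ∪v-chain →
    ℕP.<-irrefl refl (begin-strict
      s                  ≡⟨ ∣σ∣≡s ⟨
      ∣ σ ∣              <⟨ ℕP.n<1+n _ ⟩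
      suc ∣ σ ∣          ≡⟨ x∉p⇒∣p∪⁅x⁆∣≡suc∣p∣ σ v∉σ ⟨
      ∣ σ ∪ ⁅ v ⁆ ∣      ≤⟨ bound _ σ∪v-chain ⟩
      s                  ∎)
    where open ℕP.≤-Reasoning

  below⇒belowTop : ∀ {m σ} → ChainIn (below m) σ → ChainIn belowTop σ
  below⇒belowTop (σ<m , chain) = (λ x x∈σ max → max _ (σ<m x x∈σ)) , chain

  ∉-below : ∀ {m σ} → ChainIn (below m) σ → m ∉ σ
  ∉-below (σ<m , _) m∈σ = irrefl refl (σ<m _ m∈σ)

  below-∪-top : ∀ {m σ} → ChainIn (below m) σ → Chain (σ ∪ ⁅ m ⁆)
  below-∪-top {m} {σ} (σ<m , chain) x y x∈ y∈ x≢y with x∈p∪⁅y⁆⁻ σ x∈ | x∈p∪⁅y⁆⁻ σ y∈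
  ... | inj₁ x∈σ  | inj₁ y∈σ  = chain x y x∈σ y∈σ x≢y
  ... | inj₁ x∈σ  | inj₂ refl = inj₁ (σ<m x x∈σ)
  ... | inj₂ refl | inj₁ y∈σ  = inj₂ (σ<m y y∈σ)
  ... | inj₂ refl | inj₂ refl = ⊥-elim (x≢y refl)

  below-of-maximal : ∀ {m σ} → IsMaximal m → Chain (σ ∪ ⁅ m ⁆) → ∀ x → x ∈ σ → x ≢ m → x < m
  below-of-maximal {m} max chain x x∈σ x≢m with chain x m (x∈p⇒x∈p∪⁅y⁆ x∈σ) y∈p∪⁅y⁆ x≢m
  ... | inj₁ x<m = x<m
  ... | inj₂ m<x = ⊥-elim (max x m<x)

  maxChain-below⇒maxChain-∪ : ∀ {m c} → IsMaximal m → MaxChainIn (below m) c →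
                              MaxChainIn whole (c ∪ ⁅ m ⁆)
  maxChain-below⇒maxChain-∪ {m} {c} max (c-chain , maximal) =
    ((λ _ _ → tt) , below-∪-top c-chain) , λ v v∉ (_ , chain) →
      maximal v (v∉ ∘ x∈p⇒x∈p∪⁅y⁆) (c∪v<m v∉ chain , proj₂ (ChainIn-⊆ {Q = whole} (c∪v⊆ v) ((λ _ _ → tt) , chain)))
    where
    c∪v⊆ : ∀ v → c ∪ ⁅ v ⁆ ⊆ (c ∪ ⁅ m ⁆) ∪ ⁅ v ⁆
    c∪v⊆ v x∈ = case x∈p∪⁅y⁆⁻ c x∈ of λ
      { (inj₁ x∈c) → x∈p⇒x∈p∪⁅y⁆ (x∈p⇒x∈p∪⁅y⁆ x∈c) ; (inj₂ refl) → y∈p∪⁅y⁆ }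
    c∪v<m : ∀ {v} → v ∉ c ∪ ⁅ m ⁆ → Chain ((c ∪ ⁅ m ⁆) ∪ ⁅ v ⁆) → ∀ x → x ∈ c ∪ ⁅ v ⁆ → x < m
    c∪v<m v∉ chain x x∈ with x∈p∪⁅y⁆⁻ c x∈
    ... | inj₁ x∈c  = proj₁ c-chain x x∈c
    ... | inj₂ refl with chain x m y∈p∪⁅y⁆ (x∈p⇒x∈p∪⁅y⁆ y∈p∪⁅y⁆) (λ { refl → v∉ y∈p∪⁅y⁆ })
    ...   | inj₁ x<m = x<m
    ...   | inj₂ m<x = ⊥-elim (max x m<x)

  maxChain-minus-maximal : ∀ {m τ} → IsMaximal m → MaxChainIn whole τ → m ∈ τ →
                           MaxChainIn (below m) (τ - m)
  maxChain-minus-maximal {m} {τ} max ((_ , chain) , maximal) m∈τ =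
    (τ-m<m , proj₂ (ChainIn-⊆ {Q = whole} (p─q⊆p τ ⁅ m ⁆) ((λ _ _ → tt) , chain))) ,
    λ v v∉ (τ-m∪v<m , chain′) → maximal v (v∉τ v∉ (τ-m∪v<m v y∈p∪⁅y⁆))
      ((λ _ _ → tt) , subst Chain (τ-m∪v∪m≡τ∪v v) (below-∪-top (τ-m∪v<m , chain′)))
    where
    τ-m<m : ∀ x → x ∈ τ - m → x < m
    τ-m<m x x∈ = below-of-maximal max (subst Chain (sym (x∈p⇒p-x∪⁅x⁆≡p m∈τ)) chain) x x∈
                                  (proj₂ (x∈p-y⁻ x∈))
    v∉τ : ∀ {v} → v ∉ τ - m → v < m → v ∉ τ
    v∉τ v∉ v<m v∈τ = v∉ (x∈p∧x≢y⇒x∈p-y v∈τ λ { refl → irrefl refl v<m })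
    τ-m∪v∪m≡τ∪v : ∀ v → ((τ - m) ∪ ⁅ v ⁆) ∪ ⁅ m ⁆ ≡ τ ∪ ⁅ v ⁆
    τ-m∪v∪m≡τ∪v v = trans (p∪⁅x⁆∪⁅y⁆≡p∪⁅y⁆∪⁅x⁆ (τ - m) v m) (cong (_∪ ⁅ v ⁆) (x∈p⇒p-x∪⁅x⁆≡p m∈τ))

  maxChain-belowTop⇒maxChain-below : ∀ {m c} → IsMaximal m → MaxChainIn belowTop c →
                                     Chain (c ∪ ⁅ m ⁆) → MaxChainIn (below m) c
  maxChain-belowTop⇒maxChain-below {m} {c} max ((c∉M , c-chain) , maximal) chain =
    (c<m , c-chain) , λ v v∉c c∪v-chain → maximal v v∉c (below⇒belowTop c∪v-chain)
    where
    c<m : ∀ x → x ∈ c → x < m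
    c<m x x∈c = below-of-maximal max chain x x∈c λ { refl → c∉M x x∈c max }

  ∪-maximal-injective : ∀ {c c′ m m′} → (∀ x → x ∈ c → ¬ IsMaximal x) → (∀ x → x ∈ c′ → ¬ IsMaximal x) →
                        IsMaximal m → IsMaximal m′ → c ∪ ⁅ m ⁆ ≡ c′ ∪ ⁅ m′ ⁆ → c ≡ c′ × m ≡ m′
  ∪-maximal-injective {c} {c′} {m} {m′} c∉M c′∉M max max′ eq =
    ⊆-antisym (⊆-cancel c∉M max′ eq) (⊆-cancel c′∉M max (sym eq)) ,
    (case x∈p∪⁅y⁆⁻ c′ (subst (m ∈_) eq y∈p∪⁅y⁆) of λ
      { (inj₁ m∈c′) → ⊥-elim (c′∉M m m∈c′ max) ; (inj₂ m≡m′) → m≡m′ })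
    where
    ⊆-cancel : ∀ {c c′ m m′} → (∀ x → x ∈ c → ¬ IsMaximal x) → IsMaximal m′ →
               c ∪ ⁅ m ⁆ ≡ c′ ∪ ⁅ m′ ⁆ → c ⊆ c′
    ⊆-cancel {c} {c′} c∉M max′ eq {x} x∈c with x∈p∪⁅y⁆⁻ c′ (subst (x ∈_) eq (x∈p⇒x∈p∪⁅y⁆ x∈c))
    ... | inj₁ x∈c′ = x∈c′
    ... | inj₂ refl = ⊥-elim (c∉M x x∈c max′)

  last-facet-of-cycle-is-full : ∀ Q s prec z → Cycle Q s z →
                                (∀ σ → ChainIn Q σ → ∣ σ ∣ ≡ s → MaxChainIn Q σ) →
                                ∀ G → z G ≢ 0ℤ → (∀ G′ → MaxChainIn Q G′ → G′ ≢ G → prec G′ G ⊎ prec G G′) →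
                                (∀ G′ → prec G G′ → z G′ ≡ 0ℤ) → FullRestriction Q prec G
  last-facet-of-cycle-is-full Q s prec z (z-supp , ∂z≡0) maximal G zG≢0 comparable later =
    facet G zG≢0 , restriction
    where
    facet : ∀ σ → z σ ≢ 0ℤ → MaxChainIn Q σ
    facet σ z≢0 = let (σ∈Q , ∣σ∣≡s) = z-supp σ z≢0 in maximal σ σ∈Q ∣σ∣≡s
    restriction : ∀ x → x ∈ G → ∃ λ G′ → MaxChainIn Q G′ × prec G′ G × G - x ⊆ G′
    restriction x x∈G with ∂≡0⇒another-coface z G x (∂z≡0 (G - x)) x∈G zG≢0
    ... | w , w≢x , w∉G-x , zG′≢0 with comparable _ (facet _ zG′≢0) G′≢G
      where
      G′≢G : (G - x) ∪ ⁅ w ⁆ ≢ G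
      G′≢G G′≡G = w∉G-x (x∈p∧x≢y⇒x∈p-y (subst (w ∈_) G′≡G y∈p∪⁅y⁆) w≢x)
    ...   | inj₁ earlier = _ , facet _ zG′≢0 , earlier , x∈p⇒x∈p∪⁅y⁆
    ...   | inj₂ later′  = ⊥-elim (zG′≢0 (later _ later′))

module Pure {n : ℕ} (P : FinPoset n) (r : ℕ) (pure : Poset.PureOfLength P r) where
  open FinPoset P
  open Poset P
  open ChainComplex P
  open MaximalChains P

  chain-size : ∀ {σ} → Chain σ → ∣ σ ∣ ℕ.≤ suc r
  chain-size {σ} chain with extend-to-maxChain chain
  ... | τ , σ⊆τ , max = subst (∣ σ ∣ ℕ.≤_) (pure τ max) (p⊆q⇒∣p∣≤∣q∣ σ⊆τ)

  maxChain-maximal-element : ∀ {τ} → MaxChainIn whole τ → ∃ λ t → t ∈ τ × IsMaximal t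
  maxChain-maximal-element {τ} max
    with p⊆q∧∣p∣<∣q∣⇒∃∈q∖p {p = ⊥} {τ} (⊥-elim ∘ ∉⊥) (subst₂ ℕ._<_ (sym (∣⊥∣≡0 n)) (sym (pure τ max)) (ℕ.s≤s ℕ.z≤n))
  ... | x , x∈τ , _ = maxChain-top max x∈τ

  maxChain-minus-maximal-in-belowTop : ∀ {τ t} → MaxChainIn whole τ → t ∈ τ → IsMaximal t → ChainIn belowTop (τ - t)
  maxChain-minus-maximal-in-belowTop {τ} {t} ((_ , chain) , _) t∈τ max =
    (λ x x∈ → λ x-max → x-max t (x<t x x∈)) , proj₂ (ChainIn-⊆ {Q = whole} (p─q⊆p τ ⁅ t ⁆) ((λ _ _ → tt) , chain))
    where
    x<t : ∀ x → x ∈ τ - t → x < t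
    x<t x x∈ = below-of-maximal max (subst Chain (sym (x∈p⇒p-x∪⁅x⁆≡p t∈τ)) chain) x x∈ (proj₂ (x∈p-y⁻ x∈))

  belowTop-chain-size : ∀ {σ} → ChainIn belowTop σ → ∣ σ ∣ ℕ.≤ r
  belowTop-chain-size {σ} (σ∉M , chain) with extend-to-maxChain chain
  ... | τ , σ⊆τ , max with maxChain-maximal-element max
  ...   | t , t∈τ , t-max = begin
    ∣ σ ∣       ≤⟨ p⊆q⇒∣p∣≤∣q∣ σ⊆τ-t ⟩
    ∣ τ - t ∣   ≡⟨ ℕP.suc-injective (trans (x∈p⇒suc∣p-x∣≡∣p∣ τ t∈τ) (pure τ max)) ⟩
    r           ∎
    where
    open ℕP.≤-Reasoning
    σ⊆τ-t : σ ⊆ τ - t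
    σ⊆τ-t {x} x∈σ = x∈p∧x≢y⇒x∈p-y (σ⊆τ x∈σ) λ { refl → σ∉M x x∈σ t-max }

  maxChain-belowTop-⊆ : ∀ {c τ} → MaxChainIn belowTop c → c ⊆ τ → MaxChainIn whole τ →
                        ∃ λ m → IsMaximal m × τ ≡ c ∪ ⁅ m ⁆
  maxChain-belowTop-⊆ {c} {τ} c-max@((c∉M , _) , _) c⊆τ τ-max with maxChain-maximal-element τ-max
  ... | t , t∈τ , t-max = t , t-max , (begin
    τ                ≡⟨ x∈p⇒p-x∪⁅x⁆≡p t∈τ ⟨
    (τ - t) ∪ ⁅ t ⁆  ≡⟨ cong (_∪ ⁅ t ⁆) (MaxChainIn-⊆ c-max (maxChain-minus-maximal-in-belowTop τ-max t∈τ t-max) c⊆τ-t) ⟨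
    c ∪ ⁅ t ⁆        ∎)
    where
    open ≡-Reasoning
    c⊆τ-t : c ⊆ τ - t
    c⊆τ-t {x} x∈c = x∈p∧x≢y⇒x∈p-y (c⊆τ x∈c) λ { refl → c∉M x x∈c t-max }

  maxChain-belowTop-extends : ∀ {c} → MaxChainIn belowTop c →
                              ∃ λ m → IsMaximal m × MaxChainIn whole (c ∪ ⁅ m ⁆)
  maxChain-belowTop-extends c-max =
    let (τ , c⊆τ , τ-max) = extend-to-maxChain (proj₂ (proj₁ c-max))
        (m , m-max , τ≡c∪m) = maxChain-belowTop-⊆ c-max c⊆τ τ-max
    in m , m-max , subst (MaxChainIn whole) τ≡c∪m τ-max

  maxChain-below-size : ∀ {m c} → IsMaximal m → MaxChainIn (below m) c → ∣ c ∣ ≡ r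
  maxChain-below-size {m} {c} max c-max = ℕP.suc-injective (begin
    suc ∣ c ∣        ≡⟨ x∉p⇒∣p∪⁅x⁆∣≡suc∣p∣ {x = m} c (∉-below (proj₁ c-max)) ⟨
    ∣ c ∪ ⁅ m ⁆ ∣    ≡⟨ pure (c ∪ ⁅ m ⁆) (maxChain-below⇒maxChain-∪ max c-max) ⟩
    suc r            ∎)
    where open ≡-Reasoning

  maxChain-below⇒maxChain-belowTop : ∀ {m c} → IsMaximal m → MaxChainIn (below m) c → MaxChainIn belowTop c
  maxChain-below⇒maxChain-belowTop max c-max =
    ChainIn-of-maximum-size (λ _ → belowTop-chain-size) (below⇒belowTop (proj₁ c-max)) (maxChain-below-size max c-max)

  ChainIn-below-of-size-r : ∀ {m σ} → ChainIn (below m) σ → ∣ σ ∣ ≡ r → MaxChainIn (below m) σ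
  ChainIn-below-of-size-r = ChainIn-of-maximum-size (λ _ → belowTop-chain-size ∘ below⇒belowTop)

  ChainIn-belowTop-of-size-r : ∀ {σ} → ChainIn belowTop σ → ∣ σ ∣ ≡ r → MaxChainIn belowTop σ
  ChainIn-belowTop-of-size-r = ChainIn-of-maximum-size (λ _ → belowTop-chain-size)

  acyclic⇒top-cycles-vanish : Acyclic whole → ∀ z → Cycle whole (suc r) z → ∀ σ → z σ ≡ 0ℤ
  acyclic⇒top-cycles-vanish acyclic z z-cycle σ with acyclic (suc r) z z-cycle
  ... | d , d-supp , ∂d≡z = trans (sym (∂d≡z σ)) (∂-zero d d≡0 σ)
    where
    d≡0 : ∀ σ → d σ ≡ 0ℤ
    d≡0 = SupportedOn-too-large≡0 whole (suc (suc r)) d d-supp (λ _ → ℕ.s≤s ∘ chain-size ∘ proj₂)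

module Shelling {n : ℕ} (P : FinPoset n) (r : ℕ) (pure : Poset.PureOfLength P r)
                {N : ℕ} (Ω : Fin N → Subset n) (shelling : Poset.IsShellingOrder P N Ω) where
  open FinPoset P
  open Poset P
  open ChainComplex P
  open MaximalChains P
  open Pure P r pure

  Ω-injective : ∀ {i j} → Ω i ≡ Ω j → i ≡ j
  Ω-injective = proj₁ shelling

  Ω-maxChain : ∀ i → MaxChainIn whole (Ω i)
  Ω-maxChain = proj₁ (proj₂ shelling)

  Ω-surjective : ∀ σ → MaxChainIn whole σ → ∃ λ i → Ω i ≡ σ
  Ω-surjective = proj₁ (proj₂ (proj₂ shelling))

  Ω-size : ∀ i → ∣ Ω i ∣ ≡ suc r
  Ω-size i = pure (Ω i) (Ω-maxChain i)

  Ω-chain : ∀ i → Chain (Ω i)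
  Ω-chain i = proj₂ (proj₁ (Ω-maxChain i))

  shelling-step : ∀ {i j G} → i Fin.< j → G ⊆ Ω i → G ⊆ Ω j →
                  ∃ λ k → k Fin.< j × ∃ λ y → y ∈ Ω j × y ∉ G × Ω j - y ⊆ Ω k
  shelling-step {i} {j} {G} i<j G⊆Ωi G⊆Ωj with proj₂ (proj₂ (proj₂ shelling)) i j i<j
  ... | k , k<j , Ωi∩Ωj⊆ , size with p⊆q∧suc∣p∣≡∣q∣⇒p≡q-x (p∩q⊆q (Ω k) (Ω j)) size
  ...   | y , y∈Ωj , y∉Ωk∩Ωj , Ωk∩Ωj≡Ωj-y = k , k<j , y , y∈Ωj , y∉G , Ωj-y⊆Ωk
    where
    y∉G : y ∉ G
    y∉G y∈G = y∉Ωk∩Ωj (Ωi∩Ωj⊆ (x∈p∩q⁺ (G⊆Ωi y∈G , G⊆Ωj y∈G)))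
    Ωj-y⊆Ωk : Ω j - y ⊆ Ω k
    Ωj-y⊆Ωk x∈ = proj₁ (x∈p∩q⁻ (Ω k) (Ω j) (subst (_ ∈_) (sym Ωk∩Ωj≡Ωj-y) x∈))

  InPrefix : ℕ → Subset n → Set
  InPrefix j σ = ∃ λ i → toℕ i ℕ.< j × σ ⊆ Ω i

  inPrefix? : ∀ j σ → Dec (InPrefix j σ)
  inPrefix? j σ = FinP.any? λ i → toℕ i ℕ.<? j ×-dec σ ⊆? Ω i

  FacesInPrefix : ℕ → ZChain → Set
  FacesInPrefix j z = ∀ σ → z σ ≢ 0ℤ → InPrefix j σ

  FacetsInPrefix : ℕ → ZChain → Set
  FacetsInPrefix j u = ∀ σ → u σ ≢ 0ℤ → ∃ λ i → toℕ i ℕ.< j × σ ≡ Ω i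

  weaken : ∀ {j u} → FacetsInPrefix j u → FacetsInPrefix (suc j) u
  weaken u-facets σ u≢0 = let (i , i<j , σ≡Ωi) = u-facets σ u≢0 in i , ℕP.m≤n⇒m≤1+n i<j , σ≡Ωi

  ∂-elementary-Ω-faces : ∀ i σ → ∂ (elementary (Ω i)) σ ≢ 0ℤ → σ ⊆ Ω i
  ∂-elementary-Ω-faces i σ ∂e≢0 =
    let (_ , _ , σ∪v≡Ω) = ∂-elementary-nonzero (Ω i) σ ∂e≢0 in λ x∈ → subst (_ ∈_) σ∪v≡Ω (x∈p⇒x∈p∪⁅y⁆ x∈)

  ∂-elementary-Ω-cycle : ∀ i → Cycle whole r (∂ (elementary (Ω i)))
  ∂-elementary-Ω-cycle i = supp , ∂∂≡0 (elementary (Ω i)) chains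
    where
    chains : ∀ τ → elementary (Ω i) τ ≢ 0ℤ → Chain τ
    chains τ e≢0 = subst Chain (sym (elementary-nonzero (Ω i) τ e≢0)) (Ω-chain i)
    supp : SupportedOn whole r (∂ (elementary (Ω i)))
    supp σ ∂e≢0 =
      let (v , v∉σ , σ∪v≡Ω) = ∂-elementary-nonzero (Ω i) σ ∂e≢0
      in ChainIn-⊆ {Q = whole} (∂-elementary-Ω-faces i σ ∂e≢0) (proj₁ (Ω-maxChain i)) ,
         ℕP.suc-injective (trans (sym (x∉p⇒∣p∪⁅x⁆∣≡suc∣p∣ σ v∉σ)) (trans (cong ∣_∣ σ∪v≡Ω) (Ω-size i)))

  facet-of-Ω : ∀ {σ} i → σ ⊆ Ω i → ∣ σ ∣ ≡ r → ∃ λ x → x ∈ Ω i × σ ≡ Ω i - x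
  facet-of-Ω i σ⊆Ω ∣σ∣≡r with p⊆q∧suc∣p∣≡∣q∣⇒p≡q-x σ⊆Ω (trans (cong suc ∣σ∣≡r) (sym (Ω-size i)))
  ... | x , x∈Ω , _ , σ≡Ω-x = x , x∈Ω , σ≡Ω-x

  prefix-step-covered : ∀ jF z → SupportedOn whole r z →
                        (∀ x → x ∈ Ω jF → InPrefix (toℕ jF) (Ω jF - x)) →
                        FacesInPrefix (suc (toℕ jF)) z → FacesInPrefix (toℕ jF) z
  prefix-step-covered jF z z-supp covered z-faces σ z≢0 with z-faces σ z≢0
  ... | i , i<1+jF , σ⊆Ωi with ℕP.m≤n⇒m<n∨m≡n (ℕP.≤-pred i<1+jF)
  ...   | inj₁ i<jF = i , i<jF , σ⊆Ωi
  ...   | inj₂ i≡jF with FinP.toℕ-injective i≡jF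
  ...     | refl with facet-of-Ω i σ⊆Ωi (proj₂ (z-supp σ z≢0))
  ...       | x , x∈Ωi , refl = covered x x∈Ωi

  -- Killing the coefficient of the free face Ω jF − x₀ by a multiple of ∂(Ω jF) pushes the support
  -- into the earlier facets: any other face of Ω jF still carrying weight would be a second free face,
  -- and two free faces of Ω jF cannot both be cofaces of their intersection in the cycle.
  module FreeFaceElimination (jF : Fin N) (x₀ : Fin n) (x₀∈F : x₀ ∈ Ω jF)
                             (x₀-free : ¬ InPrefix (toℕ jF) (Ω jF - x₀))
                             (z : ZChain) (z-cycle : Cycle whole r z)
                             (z-faces : FacesInPrefix (suc (toℕ jF)) z) where
    F : Subset n
    F = Ω jF

    coefficient : ℤ
    coefficient = sgn (F - x₀) x₀ * z (F - x₀)

    z′ : ZChain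
    z′ = z +⟨ - coefficient ⟩ ∂ (elementary F)

    z′-cycle : Cycle whole r z′
    z′-cycle = +⟨⟩-Cycle (- coefficient) z-cycle (∂-elementary-Ω-cycle jF)

    z′-free-face≡0 : z′ (F - x₀) ≡ 0ℤ
    z′-free-face≡0 = begin
      z (F - x₀) + - coefficient * ∂ (elementary F) (F - x₀)  ≡⟨ cong (λ e → z (F - x₀) + - coefficient * e) (∂-elementary-facet F x₀ x₀∈F) ⟩
      z (F - x₀) + - (s * z (F - x₀)) * s                      ≡⟨ regroup s (z (F - x₀)) ⟩
      z (F - x₀) + - (s * s * z (F - x₀))                      ≡⟨ cong (λ t → z (F - x₀) + - (t * z (F - x₀))) (-1^n*-1^n≡1 (position (F - x₀) x₀)) ⟩
      z (F - x₀) + - (1ℤ * z (F - x₀))                         ≡⟨ cong (λ t → z (F - x₀) + - t) (ℤP.*-identityˡ _) ⟩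
      z (F - x₀) + - z (F - x₀)                                ≡⟨ ℤP.+-inverseʳ (z (F - x₀)) ⟩
      0ℤ                                                       ∎
      where
      open ≡-Reasoning
      s : ℤ
      s = sgn (F - x₀) x₀
      regroup : ∀ s a → a + - (s * a) * s ≡ a + - (s * s * a)
      regroup = solve-∀

    z′-faces : ∀ σ → z′ σ ≢ 0ℤ → InPrefix (toℕ jF) σ ⊎ σ ⊆ F
    z′-faces σ z′≢0 with +⟨⟩-nonzero z (- coefficient) (∂ (elementary F)) σ z′≢0
    ... | inj₂ ∂e≢0 = inj₂ (∂-elementary-Ω-faces jF σ ∂e≢0)
    ... | inj₁ z≢0 with z-faces σ z≢0
    ...   | i , i<1+jF , σ⊆Ωi with ℕP.m≤n⇒m<n∨m≡n (ℕP.≤-pred i<1+jF)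
    ...     | inj₁ i<jF = inj₁ (i , i<jF , σ⊆Ωi)
    ...     | inj₂ i≡jF = inj₂ (subst (λ i → σ ⊆ Ω i) (FinP.toℕ-injective i≡jF) σ⊆Ωi)

    other-free-face≡0 : ∀ x → x ∈ F → x ≢ x₀ → ¬ InPrefix (toℕ jF) (F - x) → z′ (F - x) ≡ 0ℤ
    other-free-face≡0 x x∈F x≢x₀ x-free = subst (λ σ → z′ σ ≡ 0ℤ) G∪x₀≡F-x
      (∂≡0⇒lone-coface≡0 z′ G x₀ (proj₂ z′-cycle G) (x∉p-x (F - x) x₀) others)
      where
      G : Subset n
      G = (F - x) - x₀
      G∪x₀≡F-x : G ∪ ⁅ x₀ ⁆ ≡ F - x
      G∪x₀≡F-x = x∈p⇒p-x∪⁅x⁆≡p {x = x₀} {F - x} (x∈p∧x≢y⇒x∈p-y x₀∈F (x≢x₀ ∘ sym))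
      G∪x≡F-x₀ : G ∪ ⁅ x ⁆ ≡ F - x₀
      G∪x≡F-x₀ = trans (cong (_∪ ⁅ x ⁆) (p─x─y≡p─y─x F x x₀))
                       (x∈p⇒p-x∪⁅x⁆≡p {x = x} {F - x₀} (x∈p∧x≢y⇒x∈p-y x∈F x≢x₀))
      G⊆F : G ⊆ F
      G⊆F y∈G = proj₁ (x∈p-y⁻ (proj₁ (x∈p-y⁻ y∈G)))
      ∈G : ∀ {y} → y ∈ F → y ≢ x → y ≢ x₀ → y ∈ G
      ∈G y∈F y≢x y≢x₀ = x∈p∧x≢y⇒x∈p-y (x∈p∧x≢y⇒x∈p-y y∈F y≢x) y≢x₀
      others : ∀ w → w ∉ G → w ≢ x₀ → z′ (G ∪ ⁅ w ⁆) ≡ 0ℤ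
      others w w∉G w≢x₀ with w FinP.≟ x
      ... | yes refl = subst (λ σ → z′ σ ≡ 0ℤ) (sym G∪x≡F-x₀) z′-free-face≡0
      ... | no w≢x   = decidable-stable (z′ (G ∪ ⁅ w ⁆) ≟ 0ℤ) (unweighted w∉G w≢x w≢x₀)
        where
        unweighted : ∀ {w} → w ∉ G → w ≢ x → w ≢ x₀ → ¬ z′ (G ∪ ⁅ w ⁆) ≢ 0ℤ
        unweighted w∉G w≢x w≢x₀ z′≢0 with z′-faces _ z′≢0
        ... | inj₂ G∪w⊆F = w∉G (∈G (G∪w⊆F y∈p∪⁅y⁆) w≢x w≢x₀)
        ... | inj₁ (i , i<jF , G∪w⊆Ωi) with shelling-step i<jF (G∪w⊆Ωi ∘ x∈p⇒x∈p∪⁅y⁆) G⊆F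
        ...   | k , k<jF , y , y∈F , y∉G , F-y⊆Ωk with y FinP.≟ x | y FinP.≟ x₀
        ...     | yes refl | _        = x-free (k , k<jF , F-y⊆Ωk)
        ...     | no _     | yes refl = x₀-free (k , k<jF , F-y⊆Ωk)
        ...     | no y≢x   | no y≢x₀  = y∉G (∈G y∈F y≢x y≢x₀)

    z′-faces-in-prefix : FacesInPrefix (toℕ jF) z′
    z′-faces-in-prefix σ z′≢0 with z′-faces σ z′≢0
    ... | inj₁ inPrefix = inPrefix
    ... | inj₂ σ⊆F =
      let (x , x∈F , σ≡F-x) = facet-of-Ω jF σ⊆F (proj₂ (proj₁ z′-cycle σ z′≢0))
      in subst (InPrefix (toℕ jF)) (sym σ≡F-x) (face-in-prefix x x∈F (z′≢0 ∘ trans (cong z′ σ≡F-x)))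
      where
      face-in-prefix : ∀ x → x ∈ F → z′ (F - x) ≢ 0ℤ → InPrefix (toℕ jF) (F - x)
      face-in-prefix x x∈F z′≢0 with inPrefix? (toℕ jF) (F - x) | x FinP.≟ x₀
      ... | yes inPrefix | _        = inPrefix
      ... | no _         | yes refl = ⊥-elim (z′≢0 z′-free-face≡0)
      ... | no x-free    | no x≢x₀  = ⊥-elim (z′≢0 (other-free-face≡0 x x∈F x≢x₀ x-free))

  PrefixBounds : ℕ → Set
  PrefixBounds j = ∀ z → Cycle whole r z → FacesInPrefix j z →
                   ∃ λ u → FacetsInPrefix j u × ∀ τ → ∂ u τ ≡ z τ

  empty-prefix-bounds : PrefixBounds 0
  empty-prefix-bounds z _ z-faces = (λ _ → 0ℤ) , (λ _ 0≢0 → ⊥-elim (0≢0 refl)) , λ τ →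
    trans (∂-zero (λ _ → 0ℤ) (λ _ → refl) τ)
          (sym (decidable-stable (z τ ≟ 0ℤ) λ z≢0 → case z-faces τ z≢0 of λ { (_ , () , _) }))

  prefix-step : ∀ jF → PrefixBounds (toℕ jF) → PrefixBounds (suc (toℕ jF))
  prefix-step jF bounds z z-cycle z-faces
    with FinP.any? (λ x → x ∈? Ω jF ×-dec ¬? (inPrefix? (toℕ jF) (Ω jF - x)))
  ... | no none with bounds z z-cycle (prefix-step-covered jF z (proj₁ z-cycle) covered z-faces)
    where
    covered : ∀ x → x ∈ Ω jF → InPrefix (toℕ jF) (Ω jF - x)
    covered x x∈F = decidable-stable (inPrefix? (toℕ jF) (Ω jF - x)) λ x-free → none (x , x∈F , x-free)
  ...   | u , u-facets , ∂u≡z = u , weaken u-facets , ∂u≡z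
  prefix-step jF bounds z z-cycle z-faces | yes (x₀ , x₀∈F , x₀-free)
    with bounds z′ z′-cycle z′-faces-in-prefix
    where open FreeFaceElimination jF x₀ x₀∈F x₀-free z z-cycle z-faces
  ... | u′ , u′-facets , ∂u′≡z′ = u , u-facets , ∂u≡z
    where
    open FreeFaceElimination jF x₀ x₀∈F x₀-free z z-cycle z-faces
    u : ZChain
    u = u′ +⟨ coefficient ⟩ elementary F
    u-facets : FacetsInPrefix (suc (toℕ jF)) u
    u-facets σ u≢0 with +⟨⟩-nonzero u′ coefficient (elementary F) σ u≢0
    ... | inj₁ u′≢0 = weaken u′-facets σ u′≢0
    ... | inj₂ e≢0  = jF , ℕP.n<1+n (toℕ jF) , elementary-nonzero F σ e≢0
    ∂u≡z : ∀ τ → ∂ u τ ≡ z τ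
    ∂u≡z τ = begin
      ∂ u τ                                                            ≡⟨ ∂-+⟨⟩ u′ coefficient (elementary F) τ ⟩
      ∂ u′ τ + coefficient * ∂ (elementary F) τ                          ≡⟨ cong (_+ coefficient * ∂ (elementary F) τ) (∂u′≡z′ τ) ⟩
      z τ + - coefficient * ∂ (elementary F) τ + coefficient * ∂ (elementary F) τ ≡⟨ cancel (z τ) coefficient (∂ (elementary F) τ) ⟩
      z τ                                                              ∎
      where
      open ≡-Reasoning
      cancel : ∀ a c e → a + - c * e + c * e ≡ a
      cancel = solve-∀

  prefixes-bound : ∀ j → j ℕ.≤ N → PrefixBounds j
  prefixes-bound zero    _   = empty-prefix-bounds
  prefixes-bound (suc j) j<N = subst (PrefixBounds ∘ suc) (FinP.toℕ-fromℕ< j<N)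
    (prefix-step (Fin.fromℕ< j<N)
      (subst PrefixBounds (sym (FinP.toℕ-fromℕ< j<N)) (prefixes-bound j (ℕP.<⇒≤ j<N))))

  IsFullRestrictionFacet : Fin N → Set
  IsFullRestrictionFacet j = ∀ x → x ∈ Ω j → ∃ λ k → k Fin.< j × Ω j - x ⊆ Ω k

  full⇒∂-faces-in-prefix : ∀ j → IsFullRestrictionFacet j → FacesInPrefix (toℕ j) (∂ (elementary (Ω j)))
  full⇒∂-faces-in-prefix j full σ ∂e≢0 =
    let (v , v∉σ , σ∪v≡Ωj) = ∂-elementary-nonzero (Ω j) σ ∂e≢0
        (k , k<j , Ωj-v⊆Ωk) = full v (subst (v ∈_) σ∪v≡Ωj y∈p∪⁅y⁆)
    in k , k<j , λ {x} x∈σ →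
         Ωj-v⊆Ωk (x∈p∧x≢y⇒x∈p-y (subst (x ∈_) σ∪v≡Ωj (x∈p⇒x∈p∪⁅y⁆ x∈σ)) λ { refl → v∉σ x∈σ })

  earlier-bound⇒top-cycle : ∀ j u → FacetsInPrefix (toℕ j) u → (∀ τ → ∂ u τ ≡ ∂ (elementary (Ω j)) τ) →
                            Cycle whole (suc r) (elementary (Ω j) +⟨ -1ℤ ⟩ u) ×
                            (elementary (Ω j) +⟨ -1ℤ ⟩ u) (Ω j) ≡ 1ℤ
  earlier-bound⇒top-cycle j u u-facets ∂u≡∂e = (supp , ∂t≡0) , cong₂ (λ a b → a + -1ℤ * b) (elementary-self F) u-F≡0
    where
    F : Subset n
    F = Ω j
    facet : ∀ {σ} i → σ ≡ Ω i → ChainIn whole σ × ∣ σ ∣ ≡ suc r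
    facet i refl = proj₁ (Ω-maxChain i) , Ω-size i
    supp : SupportedOn whole (suc r) (elementary F +⟨ -1ℤ ⟩ u)
    supp σ t≢0 with +⟨⟩-nonzero (elementary F) -1ℤ u σ t≢0
    ... | inj₁ e≢0 = facet j (elementary-nonzero F σ e≢0)
    ... | inj₂ u≢0 = let (i , _ , σ≡Ωi) = u-facets σ u≢0 in facet i σ≡Ωi
    ∂t≡0 : ∀ σ → ∂ (elementary F +⟨ -1ℤ ⟩ u) σ ≡ 0ℤ
    ∂t≡0 σ = begin
      ∂ (elementary F +⟨ -1ℤ ⟩ u) σ                       ≡⟨ ∂-+⟨⟩ (elementary F) -1ℤ u σ ⟩
      ∂ (elementary F) σ + -1ℤ * ∂ u σ                    ≡⟨ cong (λ b → ∂ (elementary F) σ + -1ℤ * b) (∂u≡∂e σ) ⟩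
      ∂ (elementary F) σ + -1ℤ * ∂ (elementary F) σ       ≡⟨ cancel (∂ (elementary F) σ) ⟩
      0ℤ                                                  ∎
      where
      open ≡-Reasoning
      cancel : ∀ a → a + -1ℤ * a ≡ 0ℤ
      cancel = solve-∀
    u-F≡0 : u F ≡ 0ℤ
    u-F≡0 = decidable-stable (u F ≟ 0ℤ) λ u≢0 → case u-facets F u≢0 of λ
      { (i , i<j , F≡Ωi) → ℕP.<-irrefl (cong toℕ (Ω-injective (sym F≡Ωi))) i<j }

  -- A full facet Ω j would make ∂(Ω j) bound by earlier facets, leaving a nonzero top-dimensional cycle.
  no-full-facet : Acyclic whole → ∀ j → ¬ IsFullRestrictionFacet j
  no-full-facet acyclic j full =
    let (u , u-facets , ∂u≡∂e) = prefixes-bound (toℕ j) (ℕP.<⇒≤ (FinP.toℕ<n j)) (∂ (elementary (Ω j)))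
                                   (∂-elementary-Ω-cycle j) (full⇒∂-faces-in-prefix j full)
        (t-cycle , t-Ωj≡1) = earlier-bound⇒top-cycle j u u-facets ∂u≡∂e
    in case trans (sym t-Ωj≡1) (acyclic⇒top-cycles-vanish acyclic _ t-cycle (Ω j)) of λ ()

module InducedShellings {n : ℕ} (P : FinPoset n) (r : ℕ) (pure : Poset.PureOfLength P r)
                        {N : ℕ} (Ω : Fin N → Subset n) (shelling : Poset.IsShellingOrder P N Ω)
                        (acyclic : Poset.Acyclic P (Poset.whole P)) where
  open FinPoset P
  open Poset P
  open ChainComplex P
  open MaximalChains P
  open Pure P r pure
  open Shelling P r pure Ω shelling
  open Induced Ω

  isExtension? : ∀ c i → Dec (IsExtension c i)
  isExtension? c i = FinP.any? λ m → isMaximal? m ×-dec Ω i ≟ˢ (c ∪ ⁅ m ⁆)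

  earliest-extension : ∀ {c} i → IsExtension c i → ∃ (EarliestExtension c)
  earliest-extension {c} = All.wfRec FinInd.<-wellFounded 0ℓ (λ i → IsExtension c i → ∃ (EarliestExtension c)) step
    where
    step : ∀ i → (∀ {i′} → i′ Fin.< i → IsExtension c i′ → ∃ (EarliestExtension c)) →
           IsExtension c i → ∃ (EarliestExtension c)
    step i earlier ext with FinP.any? (λ i′ → i′ FinP.<? i ×-dec isExtension? c i′)
    ... | yes (i′ , i′<i , ext′) = earlier i′<i ext′
    ... | no none = i , ext , λ i′ ext′ → ℕP.≮⇒≥ λ i′<i → none (i′ , i′<i , ext′)

  EarliestExtension-unique : ∀ {c i j} → EarliestExtension c i → EarliestExtension c j → i ≡ j
  EarliestExtension-unique (ext-i , least-i) (ext-j , least-j) = FinP.≤-antisym (least-i _ ext-j) (least-j _ ext-i)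

  EarliestExtension-injective : ∀ {c c′ i} → (∀ x → x ∈ c → ¬ IsMaximal x) → (∀ x → x ∈ c′ → ¬ IsMaximal x) →
                                EarliestExtension c i → EarliestExtension c′ i → c ≡ c′
  EarliestExtension-injective c∉M c′∉M ((m , m-max , Ωi≡c∪m) , _) ((m′ , m′-max , Ωi≡c′∪m′) , _) =
    proj₁ (∪-maximal-injective c∉M c′∉M m-max m′-max (trans (sym Ωi≡c∪m) Ωi≡c′∪m′))

  maxChain-belowTop-earliest-extension : ∀ {c} → MaxChainIn belowTop c → ∃ (EarliestExtension c)
  maxChain-belowTop-earliest-extension c-max =
    let (m , m-max , c∪m-max) = maxChain-belowTop-extends c-max
        (i , Ωi≡c∪m) = Ω-surjective _ c∪m-max
    in earliest-extension i (m , m-max , Ωi≡c∪m)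

  ⊆Ω⇒IsExtension : ∀ {c k} → MaxChainIn belowTop c → c ⊆ Ω k → IsExtension c k
  ⊆Ω⇒IsExtension {k = k} c-max c⊆Ωk = maxChain-belowTop-⊆ c-max c⊆Ωk (Ω-maxChain k)

  Ω-index : ∀ {m c} → IsMaximal m → MaxChainIn (below m) c → ∃ λ j → Ω j ≡ c ∪ ⁅ m ⁆
  Ω-index m-max c-max = Ω-surjective _ (maxChain-below⇒maxChain-∪ m-max c-max)

  -- If an earlier facet contained c, then Ω j = c ∪ {m} would be a full restriction facet of Ω.
  𝓕Below⇒no-earlier-facet : ∀ {m c i j} → IsMaximal m → 𝓕Below m c → Ω j ≡ c ∪ ⁅ m ⁆ →
                            c ⊆ Ω i → ¬ i Fin.< j
  𝓕Below⇒no-earlier-facet {m} {c} {i} {j} m-max (c-max , restriction) Ωj≡c∪m c⊆Ωi i<j =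
    no-full-facet acyclic j full
    where
    split : ∀ {y} → y ∈ Ω j → y ∈ c ⊎ y ≡ m
    split y∈ = x∈p∪⁅y⁆⁻ c (subst (_ ∈_) Ωj≡c∪m y∈)
    full : ∀ x → x ∈ Ω j → ∃ λ k → k Fin.< j × Ω j - x ⊆ Ω k
    full x x∈ with split x∈
    ... | inj₂ refl = i , i<j , λ y∈ → case split (proj₁ (x∈p-y⁻ y∈)) of λ
      { (inj₁ y∈c) → c⊆Ωi y∈c ; (inj₂ refl) → ⊥-elim (proj₂ (x∈p-y⁻ y∈) refl) }
    ... | inj₁ x∈c with restriction x x∈c
    ...   | c′ , _ , (i′ , j′ , Ωi′≡c′∪m , Ωj′≡c∪m , i′<j′) , c-x⊆c′
      with Ω-injective (trans Ωj′≡c∪m (sym Ωj≡c∪m))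
    ...     | refl = i′ , i′<j′ , λ {y} y∈ → subst (y ∈_) (sym Ωi′≡c′∪m) (case split (proj₁ (x∈p-y⁻ y∈)) of λ
      { (inj₁ y∈c) → x∈p⇒x∈p∪⁅y⁆ (c-x⊆c′ (x∈p∧x≢y⇒x∈p-y y∈c (proj₂ (x∈p-y⁻ y∈))))
      ; (inj₂ refl) → y∈p∪⁅y⁆ })

  𝓕Below⇒EarliestExtension : ∀ {m c j} → IsMaximal m → 𝓕Below m c → Ω j ≡ c ∪ ⁅ m ⁆ →
                             EarliestExtension c j
  𝓕Below⇒EarliestExtension m-max c-full Ωj≡c∪m = (_ , m-max , Ωj≡c∪m) , λ i (m′ , _ , Ωi≡c∪m′) →
    ℕP.≮⇒≥ (𝓕Below⇒no-earlier-facet m-max c-full Ωj≡c∪m (λ x∈c → subst (_ ∈_) (sym Ωi≡c∪m′) (x∈p⇒x∈p∪⁅y⁆ x∈c)))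

  𝓕Below⇒𝓕BelowTop : ∀ m c → IsMaximal m → 𝓕Below m c → 𝓕BelowTop c
  𝓕Below⇒𝓕BelowTop m c m-max c-full@(c-max , restriction) =
    maxChain-below⇒maxChain-belowTop m-max c-max , restriction′
    where
    restriction′ : ∀ x → x ∈ c → ∃ λ c′ → MaxChainIn belowTop c′ × PrecBelowTop c′ c × c - x ⊆ c′
    restriction′ x x∈c =
      let (c′ , c′-max , (i′ , j , Ωi′≡c′∪m , Ωj≡c∪m , i′<j) , c-x⊆c′) = restriction x x∈c
          (i , c′-earliest) = earliest-extension i′ (m , m-max , Ωi′≡c′∪m)
      in c′ , maxChain-below⇒maxChain-belowTop m-max c′-max ,
         (i , j , c′-earliest , 𝓕Below⇒EarliestExtension m-max c-full Ωj≡c∪m ,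
          ℕP.≤-<-trans (proj₂ c′-earliest i′ (m , m-max , Ωi′≡c′∪m)) i′<j) ,
         c-x⊆c′

  𝓕Below-unique : ∀ m m′ c → IsMaximal m → IsMaximal m′ → 𝓕Below m c → 𝓕Below m′ c → m ≡ m′
  𝓕Below-unique m m′ c m-max m′-max c-full c-full′ =
    let (j , Ωj≡c∪m) = Ω-index m-max (proj₁ c-full)
        (j′ , Ωj′≡c∪m′) = Ω-index m′-max (proj₁ c-full′)
        j≡j′ = EarliestExtension-unique (𝓕Below⇒EarliestExtension m-max c-full Ωj≡c∪m)
                                        (𝓕Below⇒EarliestExtension m′-max c-full′ Ωj′≡c∪m′)
        c∉M = proj₁ (below⇒belowTop (proj₁ (proj₁ c-full)))
    in proj₂ (∪-maximal-injective c∉M c∉M m-max m′-max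
                (trans (sym Ωj≡c∪m) (trans (cong Ω j≡j′) Ωj′≡c∪m′)))

  -- The shelling step applied to c − x ⊆ Ω i ∩ Ω j yields a facet Ω k missing one element of Ω j = c ∪ {m};
  -- it cannot miss m, for then Ω k would be an extension of c earlier than Ω j.
  earlier-facet-through-top : ∀ {m c j x i} → IsMaximal m → MaxChainIn belowTop c → Ω j ≡ c ∪ ⁅ m ⁆ →
                              (∀ i′ → IsExtension c i′ → j Fin.≤ i′) → x ∈ c → i Fin.< j → c - x ⊆ Ω i →
                              ∃ λ k → k Fin.< j × m ∈ Ω k × c - x ⊆ Ω k - m
  earlier-facet-through-top {m} {c} {j} {x} m-max c-max Ωj≡c∪m least x∈c i<j c-x⊆Ωi
    with shelling-step i<j c-x⊆Ωi (λ u∈ → c⊆Ωj (proj₁ (x∈p-y⁻ u∈)))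
    where
    c⊆Ωj : c ⊆ Ω j
    c⊆Ωj u∈c = subst (_ ∈_) (sym Ωj≡c∪m) (x∈p⇒x∈p∪⁅y⁆ u∈c)
  ... | k , k<j , y , y∈Ωj , y∉c-x , Ωj-y⊆Ωk = k , k<j , m∈Ωk , c-x⊆Ωk-m
    where
    m∉c : m ∉ c
    m∉c m∈c = proj₁ (proj₁ c-max) m m∈c m-max
    c⊆Ωj : c ⊆ Ω j
    c⊆Ωj u∈c = subst (_ ∈_) (sym Ωj≡c∪m) (x∈p⇒x∈p∪⁅y⁆ u∈c)
    y≡x : y ≡ x
    y≡x with x∈p∪⁅y⁆⁻ c (subst (y ∈_) Ωj≡c∪m y∈Ωj)
    ... | inj₂ refl = ⊥-elim (ℕP.<⇒≱ k<j (least k (⊆Ω⇒IsExtension c-max c⊆Ωk)))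
      where
      c⊆Ωk : c ⊆ Ω k
      c⊆Ωk u∈c = Ωj-y⊆Ωk (x∈p∧x≢y⇒x∈p-y (c⊆Ωj u∈c) λ { refl → m∉c u∈c })
    ... | inj₁ y∈c = decidable-stable (y FinP.≟ x) (y∉c-x ∘ x∈p∧x≢y⇒x∈p-y y∈c)
    ∈Ωk : ∀ {u} → u ∈ Ω j → u ≢ x → u ∈ Ω k
    ∈Ωk u∈Ωj u≢x = Ωj-y⊆Ωk (x∈p∧x≢y⇒x∈p-y u∈Ωj (u≢x ∘ flip trans y≡x))
    m∈Ωk : m ∈ Ω k
    m∈Ωk = ∈Ωk (subst (m ∈_) (sym Ωj≡c∪m) y∈p∪⁅y⁆) λ { refl → m∉c x∈c }
    c-x⊆Ωk-m : c - x ⊆ Ω k - m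
    c-x⊆Ωk-m u∈ = let (u∈c , u≢x) = x∈p-y⁻ u∈ in
      x∈p∧x≢y⇒x∈p-y (∈Ωk (c⊆Ωj u∈c) u≢x) λ { refl → m∉c u∈c }

  𝓕BelowTop⇒𝓕Below : ∀ c → 𝓕BelowTop c → ∃ λ m → IsMaximal m × 𝓕Below m c
  𝓕BelowTop⇒𝓕Below c (c-max , restriction) =
    let (j , c-earliest@((m , m-max , Ωj≡c∪m) , least)) = maxChain-belowTop-earliest-extension c-max
        c∪m-chain = subst Chain Ωj≡c∪m (Ω-chain j)
        restriction′ : ∀ x → x ∈ c → ∃ λ c′ → MaxChainIn (below m) c′ × PrecBelow m c′ c × c - x ⊆ c′
        restriction′ x x∈c =
          let (c″ , _ , (i , j′ , ((_ , _ , Ωi≡c″∪m′) , _) , c-earliest′ , i<j′) , c-x⊆c″) = restriction x x∈c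
              i<j = subst (i Fin.<_) (EarliestExtension-unique c-earliest′ c-earliest) i<j′
              (k , k<j , m∈Ωk , c-x⊆Ωk-m) = earlier-facet-through-top m-max c-max Ωj≡c∪m least x∈c i<j
                  (λ u∈ → subst (_ ∈_) (sym Ωi≡c″∪m′) (x∈p⇒x∈p∪⁅y⁆ (c-x⊆c″ u∈)))
          in Ω k - m , maxChain-minus-maximal m-max (Ω-maxChain k) m∈Ωk ,
             (k , j , sym (x∈p⇒p-x∪⁅x⁆≡p m∈Ωk) , Ωj≡c∪m , k<j) , c-x⊆Ωk-m
    in m , m-max , maxChain-belowTop⇒maxChain-below m-max c-max c∪m-chain , restriction′

  PrecBelow-total : ∀ {m c G j} → IsMaximal m → Ω j ≡ c ∪ ⁅ m ⁆ → (∀ x → x ∈ c → ¬ IsMaximal x) →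
                    MaxChainIn (below m) G → G ≢ c → PrecBelow m G c ⊎ PrecBelow m c G
  PrecBelow-total {m} {c} {G} {j} m-max Ωj≡c∪m c∉M G-max G≢c = compare (Ω-index m-max G-max)
    where
    compare : ∃ (λ j′ → Ω j′ ≡ G ∪ ⁅ m ⁆) → PrecBelow m G c ⊎ PrecBelow m c G
    compare (j′ , Ωj′≡G∪m) with FinP.<-cmp j′ j
    ... | tri< j′<j _ _ = inj₁ (j′ , j , Ωj′≡G∪m , Ωj≡c∪m , j′<j)
    ... | tri> _ _ j<j′ = inj₂ (j , j′ , Ωj≡c∪m , Ωj′≡G∪m , j<j′)
    ... | tri≈ _ refl _ = ⊥-elim (G≢c (proj₁ (∪-maximal-injective (proj₁ (below⇒belowTop (proj₁ G-max))) c∉M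
                                                                  m-max m-max (trans (sym Ωj′≡G∪m) Ωj≡c∪m))))

  PrecBelowTop-total : ∀ {c G j} → EarliestExtension c j → (∀ x → x ∈ c → ¬ IsMaximal x) →
                       MaxChainIn belowTop G → G ≢ c → PrecBelowTop G c ⊎ PrecBelowTop c G
  PrecBelowTop-total {c} {G} {j} c-earliest c∉M G-max G≢c = compare (maxChain-belowTop-earliest-extension G-max)
    where
    compare : ∃ (EarliestExtension G) → PrecBelowTop G c ⊎ PrecBelowTop c G
    compare (j′ , G-earliest) with FinP.<-cmp j′ j
    ... | tri< j′<j _ _ = inj₁ (j′ , j , G-earliest , c-earliest , j′<j)
    ... | tri> _ _ j<j′ = inj₂ (j , j′ , c-earliest , G-earliest , j<j′)
    ... | tri≈ _ refl _ = ⊥-elim (G≢c (EarliestExtension-injective (proj₁ (proj₁ G-max)) c∉M G-earliest c-earliest))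

  module ShellingBasis
    (ρ : Fin n → Subset n → ZChain)
    (ρ-basis : ∀ m → IsMaximal m → ∀ F → 𝓕Below m F →
                 Cycle (below m) r (ρ m F)
               × (∀ F′ → 𝓕Below m F′ → (F ≡ F′ → ρ m F F′ ≡ 1ℤ) × (F ≢ F′ → ρ m F F′ ≡ 0ℤ))) where

    Basis : Fin n → Subset n → Set
    Basis m F = IsMaximal m × 𝓕Below m F

    ρ-cycle : ∀ {m F} → Basis m F → Cycle (below m) r (ρ m F)
    ρ-cycle (m-max , F-full) = proj₁ (ρ-basis _ m-max _ F-full)

    ρ-self : ∀ {m F} → Basis m F → ρ m F F ≡ 1ℤ
    ρ-self (m-max , F-full) = proj₁ (proj₂ (ρ-basis _ m-max _ F-full) _ F-full) refl

    ρ-other : ∀ {m F F′} → Basis m F → 𝓕Below m F′ → F ≢ F′ → ρ m F F′ ≡ 0ℤ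
    ρ-other (m-max , F-full) F′-full = proj₂ (proj₂ (ρ-basis _ m-max _ F-full) _ F′-full)

    ρ-support : ∀ {m F c} → Basis m F → ρ m F c ≢ 0ℤ → MaxChainIn (below m) c
    ρ-support b ρ≢0 = let (c-chain , ∣c∣≡r) = proj₁ (ρ-cycle b) _ ρ≢0 in ChainIn-below-of-size-r c-chain ∣c∣≡r

    ρ-cycle-belowTop : ∀ {m F} → Basis m F → Cycle belowTop r (ρ m F)
    ρ-cycle-belowTop b = (λ σ ρ≢0 → let (σ-chain , size) = proj₁ (ρ-cycle b) σ ρ≢0 in below⇒belowTop σ-chain , size) ,
                         proj₂ (ρ-cycle b)

    -- The last chain in the support of ρ m F (in the order Ω^{<m}) is a full restriction facet of P_{<m},
    -- hence F itself.
    ρ-vanishes-after : ∀ {m F jF} → Basis m F → Ω jF ≡ F ∪ ⁅ m ⁆ →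
                       ∀ j {c} → Ω j ≡ c ∪ ⁅ m ⁆ → jF Fin.< j → ρ m F c ≡ 0ℤ
    ρ-vanishes-after {m} {F} {jF} b ΩjF≡F∪m = All.wfRec FinInd.>-wellFounded 0ℓ Vanishes step
      where
      Vanishes : Fin N → Set
      Vanishes j = ∀ {c} → Ω j ≡ c ∪ ⁅ m ⁆ → jF Fin.< j → ρ m F c ≡ 0ℤ
      step : ∀ j → (∀ {j′} → j Fin.< j′ → Vanishes j′) → Vanishes j
      step j later-vanish {c} Ωj≡c∪m jF<j = decidable-stable (ρ m F c ≟ 0ℤ) nonzero-impossible
        where
        nonzero-impossible : ¬ ρ m F c ≢ 0ℤ
        nonzero-impossible ρ≢0 = ρ≢0 (ρ-other b c-full F≢c)
          where
          c-max : MaxChainIn (below m) c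
          c-max = ρ-support b ρ≢0
          later : ∀ G → PrecBelow m c G → ρ m F G ≡ 0ℤ
          later G (i , j′ , Ωi≡c∪m , Ωj′≡G∪m , i<j′) with Ω-injective (trans Ωi≡c∪m (sym Ωj≡c∪m))
          ... | refl = later-vanish i<j′ Ωj′≡G∪m (FinP.<-trans jF<j i<j′)
          c-full : 𝓕Below m c
          c-full = last-facet-of-cycle-is-full (below m) r (PrecBelow m) (ρ m F) (ρ-cycle b)
                     (λ _ → ChainIn-below-of-size-r) c ρ≢0
                     (λ G G-max G≢c → PrecBelow-total (proj₁ b) Ωj≡c∪m (proj₁ (below⇒belowTop (proj₁ c-max))) G-max G≢c)
                     later
          F≢c : F ≢ c
          F≢c F≡c = FinP.<⇒≢ jF<j (Ω-injective (trans ΩjF≡F∪m (trans (cong (_∪ ⁅ m ⁆) F≡c) (sym Ωj≡c∪m))))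

    -- Ordering basis elements by the Ω-index of F ∪ {m}, the family is unitriangular: ρ m′ F′ is
    -- supported on chains whose extensions do not come later, and F ∪ {m} is the earliest extension of F.
    ρ-independent : ∀ (a : Coeffs Basis) d → SupportedOn belowTop (suc r) d →
                    (∀ σ → combination (proj₁ a) ρ σ ≡ ∂ d σ) → ∀ m c → proj₁ a m c ≡ 0ℤ
    ρ-independent (a , a-basis) d d-supp combination≡∂d m c =
      decidable-stable (a m c ≟ 0ℤ) λ a≢0 →
        let b = a-basis m c a≢0
            (j , Ωj≡c∪m) = Ω-index (proj₁ b) (proj₁ (proj₂ b))
        in a≢0 (vanishes j b Ωj≡c∪m)
      where
      combination≡0 : ∀ σ → combination a ρ σ ≡ 0ℤ
      combination≡0 σ = trans (combination≡∂d σ) (∂-zero d d≡0 σ)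
        where
        d≡0 : ∀ σ → d σ ≡ 0ℤ
        d≡0 = SupportedOn-too-large≡0 belowTop (suc r) d d-supp (λ _ → ℕ.s≤s ∘ belowTop-chain-size)
      Vanishes : Fin N → Set
      Vanishes j = ∀ {m c} → Basis m c → Ω j ≡ c ∪ ⁅ m ⁆ → a m c ≡ 0ℤ
      diagonal : ∀ j → (∀ {j′} → j Fin.< j′ → Vanishes j′) → ∀ {m c} → Basis m c → Ω j ≡ c ∪ ⁅ m ⁆ →
                 ∀ m′ c′ → a m′ c′ ≢ 0ℤ → ρ m′ c′ c ≢ 0ℤ → m′ ≡ m × c′ ≡ c
      diagonal j later-vanish {m} {c} b Ωj≡c∪m m′ c′ a≢0 ρ≢0 =
        let b′ = a-basis m′ c′ a≢0
            (j′ , Ωj′≡c′∪m′) = Ω-index (proj₁ b′) (proj₁ (proj₂ b′))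
            (j″ , Ωj″≡c∪m′) = Ω-index (proj₁ b′) (ρ-support b′ ρ≢0)
            j≤j″ : j Fin.≤ j″
            j≤j″ = proj₂ (𝓕Below⇒EarliestExtension (proj₁ b) (proj₂ b) Ωj≡c∪m) j″ (m′ , proj₁ b′ , Ωj″≡c∪m′)
            j″≤j′ : j″ Fin.≤ j′
            j″≤j′ = ℕP.≮⇒≥ λ j′<j″ → ρ≢0 (ρ-vanishes-after b′ Ωj′≡c′∪m′ j″ Ωj″≡c∪m′ j′<j″)
            j′≤j : j′ Fin.≤ j
            j′≤j = ℕP.≮⇒≥ λ j<j′ → a≢0 (later-vanish j<j′ b′ Ωj′≡c′∪m′)
            c∉M = proj₁ (below⇒belowTop (proj₁ (proj₁ (proj₂ b))))
            c′∉M = proj₁ (below⇒belowTop (proj₁ (proj₁ (proj₂ b′))))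
            (c′≡c , m′≡m) = ∪-maximal-injective c′∉M c∉M (proj₁ b′) (proj₁ b)
                              (trans (sym Ωj′≡c′∪m′) (trans (cong Ω (FinP.≤-antisym j′≤j (ℕP.≤-trans j≤j″ j″≤j′))) Ωj≡c∪m))
        in m′≡m , c′≡c
      step : ∀ j → (∀ {j′} → j Fin.< j′ → Vanishes j′) → Vanishes j
      step j later-vanish {m} {c} b Ωj≡c∪m = begin
        a m c                      ≡⟨ ℤP.*-identityʳ (a m c) ⟨
        a m c * 1ℤ                 ≡⟨ cong (a m c *_) (ρ-self b) ⟨
        a m c * ρ m c c            ≡⟨ combination-concentrated a ρ c m c off-diagonal ⟨
        combination a ρ c          ≡⟨ combination≡0 c ⟩
        0ℤ                         ∎
        where
        open ≡-Reasoning
        off-diagonal : ∀ m′ c′ → ¬ (m′ ≡ m × c′ ≡ c) → a m′ c′ * ρ m′ c′ c ≡ 0ℤ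
        off-diagonal m′ c′ ≢mc with a m′ c′ ≟ 0ℤ | ρ m′ c′ c ≟ 0ℤ
        ... | yes a≡0 | _       = cong (_* ρ m′ c′ c) a≡0
        ... | no _    | yes ρ≡0 = trans (cong (a m′ c′ *_) ρ≡0) (ℤP.*-zeroʳ (a m′ c′))
        ... | no a≢0  | no ρ≢0  = ⊥-elim (≢mc (diagonal j later-vanish b Ωj≡c∪m m′ c′ a≢0 ρ≢0))
      vanishes : ∀ j → Vanishes j
      vanishes = All.wfRec FinInd.>-wellFounded 0ℓ Vanishes step

    InSpan : ZChain → Set
    InSpan z = Σ (Coeffs Basis) λ a → ∀ σ → z σ ≡ combination (proj₁ a) ρ σ

    IndexBounded : ℕ → ZChain → Set
    IndexBounded k z = ∀ c → z c ≢ 0ℤ → ∀ i → EarliestExtension c i → toℕ i ℕ.< k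

    -- No chain after c carries weight, so c is a full restriction facet of P ∖ M and part (i) applies.
    latest-chain-basis : ∀ k z → Cycle belowTop r z → IndexBounded (suc k) z → ∀ c → z c ≢ 0ℤ →
                         ∀ i → toℕ i ≡ k → EarliestExtension c i → ∃ λ m → Basis m c × Ω i ≡ c ∪ ⁅ m ⁆
    latest-chain-basis k z z-cycle z-bounded c zc≢0 i toℕi≡k c-earliest =
      let (m , b) = 𝓕BelowTop⇒𝓕Below c c-full
          (j , Ωj≡c∪m) = Ω-index (proj₁ b) (proj₁ (proj₂ b))
          j≡i = EarliestExtension-unique (𝓕Below⇒EarliestExtension (proj₁ b) (proj₂ b) Ωj≡c∪m) c-earliest
      in m , b , subst (λ j → Ω j ≡ c ∪ ⁅ m ⁆) j≡i Ωj≡c∪m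
      where
      later : ∀ G → PrecBelowTop c G → z G ≡ 0ℤ
      later G (i′ , j , c-earliest′ , G-earliest , i′<j) = decidable-stable (z G ≟ 0ℤ) λ zG≢0 →
        ℕP.<⇒≱ (subst (ℕ._< toℕ j) (trans (cong toℕ (EarliestExtension-unique c-earliest′ c-earliest)) toℕi≡k) i′<j)
               (ℕP.≤-pred (z-bounded G zG≢0 j G-earliest))
      c-full : 𝓕BelowTop c
      c-full = last-facet-of-cycle-is-full belowTop r PrecBelowTop z z-cycle (λ _ → ChainIn-belowTop-of-size-r)
                 c zc≢0 (λ G G-max G≢c → PrecBelowTop-total c-earliest (proj₁ (proj₁ (proj₁ z-cycle c zc≢0))) G-max G≢c)
                 later

    -- Subtracting z(c) ρ m c from z for the chain c of latest extension lowers the bound on the support.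
    module LastChainElimination (k : ℕ) (z : ZChain) (z-cycle : Cycle belowTop r z)
                                (z-bounded : IndexBounded (suc k) z) (c : Subset n) (zc≢0 : z c ≢ 0ℤ)
                                (i : Fin N) (toℕi≡k : toℕ i ≡ k) (c-earliest : EarliestExtension c i)
                                (m : Fin n) (b : Basis m c) (Ωi≡c∪m : Ω i ≡ c ∪ ⁅ m ⁆) where
      c∉M : ∀ x → x ∈ c → ¬ IsMaximal x
      c∉M = proj₁ (proj₁ (proj₁ z-cycle c zc≢0))

      z′ : ZChain
      z′ = z +⟨ - z c ⟩ ρ m c

      z′-cycle : Cycle belowTop r z′
      z′-cycle = +⟨⟩-Cycle (- z c) z-cycle (ρ-cycle-belowTop b)

      z′c≡0 : z′ c ≡ 0ℤ
      z′c≡0 = begin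
        z c + - z c * ρ m c c    ≡⟨ cong (λ t → z c + - z c * t) (ρ-self b) ⟩
        z c + - z c * 1ℤ         ≡⟨ cong (z c +_) (ℤP.*-identityʳ (- z c)) ⟩
        z c + - z c              ≡⟨ ℤP.+-inverseʳ (z c) ⟩
        0ℤ                       ∎
        where open ≡-Reasoning

      index≢i : ∀ {c′ i′} → z′ c′ ≢ 0ℤ → EarliestExtension c′ i′ → toℕ i′ ≢ k
      index≢i {c′} z′≢0 c′-earliest toℕi′≡k =
        z′≢0 (subst (λ σ → z′ σ ≡ 0ℤ) (sym c′≡c) z′c≡0)
        where
        c′≡c : c′ ≡ c
        c′≡c = EarliestExtension-injective (proj₁ (proj₁ (proj₁ z′-cycle c′ z′≢0))) c∉M
                 (subst (EarliestExtension c′) (FinP.toℕ-injective (trans toℕi′≡k (sym toℕi≡k))) c′-earliest)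
                 c-earliest

      index≤k : ∀ {c′ i′} → z′ c′ ≢ 0ℤ → EarliestExtension c′ i′ → toℕ i′ ℕ.≤ k
      index≤k {c′} {i′} z′≢0 c′-earliest with +⟨⟩-nonzero z (- z c) (ρ m c) c′ z′≢0
      ... | inj₁ z≢0 = ℕP.≤-pred (z-bounded c′ z≢0 i′ c′-earliest)
      ... | inj₂ ρ≢0 =
        let (j , Ωj≡c′∪m) = Ω-index (proj₁ b) (ρ-support b ρ≢0)
        in begin
          toℕ i′   ≤⟨ proj₂ c′-earliest j (m , proj₁ b , Ωj≡c′∪m) ⟩
          toℕ j    ≤⟨ ℕP.≮⇒≥ (λ i<j → ρ≢0 (ρ-vanishes-after b Ωi≡c∪m j Ωj≡c′∪m i<j)) ⟩
          toℕ i    ≡⟨ toℕi≡k ⟩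
          k        ∎
        where open ℕP.≤-Reasoning

      z′-bounded : IndexBounded k z′
      z′-bounded c′ z′≢0 i′ c′-earliest = ℕP.≤∧≢⇒< (index≤k z′≢0 c′-earliest) (index≢i z′≢0 c′-earliest)

      lift : InSpan z′ → InSpan z
      lift ((a′ , a′-basis) , z′≡) = (a , a-basis) , z≡
        where
        a : Fin n → Subset n → ℤ
        a m′ c′ = a′ m′ c′ + unitCoeff m c (z c) m′ c′
        a-basis : ∀ m′ c′ → a m′ c′ ≢ 0ℤ → Basis m′ c′
        a-basis m′ c′ a≢0 with a′ m′ c′ ≟ 0ℤ
        ... | no a′≢0 = a′-basis m′ c′ a′≢0
        ... | yes a′≡0 =
          let (m′≡m , c′≡c) = unitCoeff-nonzero m c (z c) m′ c′ (a≢0 ∘ cong₂ _+_ a′≡0)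
          in subst₂ Basis (sym m′≡m) (sym c′≡c) b
        z≡ : ∀ σ → z σ ≡ combination a ρ σ
        z≡ σ = begin
          z σ                                                    ≡⟨ restore (z σ) (z c) (ρ m c σ) ⟨
          z σ + - z c * ρ m c σ + z c * ρ m c σ                  ≡⟨ cong (_+ z c * ρ m c σ) (z′≡ σ) ⟩
          combination a′ ρ σ + z c * ρ m c σ                     ≡⟨ cong (combination a′ ρ σ +_) (combination-unitCoeff m c (z c) ρ σ) ⟨
          combination a′ ρ σ + combination (unitCoeff m c (z c)) ρ σ ≡⟨ combination-distrib-+ a′ (unitCoeff m c (z c)) ρ σ ⟨
          combination a ρ σ                                      ∎
          where
          open ≡-Reasoning
          restore : ∀ x y w → x + - y * w + y * w ≡ x
          restore = solve-∀

    EarliestExtension? : ∀ c i → Dec (EarliestExtension c i)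
    EarliestExtension? c i = isExtension? c i ×-dec FinP.all? (λ i′ → isExtension? c i′ →-dec i FinP.≤? i′)

    ρ-spans-bounded : ∀ k z → Cycle belowTop r z → IndexBounded k z → InSpan z
    ρ-spans-bounded zero z z-cycle z-bounded =
      ((λ _ _ → 0ℤ) , λ _ _ 0≢0 → ⊥-elim (0≢0 refl)) , λ σ →
        trans (z≡0 σ) (sym (sumFin-zero {n} _ λ _ → sumSub-zero {n} _ λ _ → refl))
      where
      z≡0 : ∀ σ → z σ ≡ 0ℤ
      z≡0 σ = decidable-stable (z σ ≟ 0ℤ) λ z≢0 →
        let (σ-chain , ∣σ∣≡r) = proj₁ z-cycle σ z≢0
            (i , σ-earliest) = maxChain-belowTop-earliest-extension (ChainIn-belowTop-of-size-r σ-chain ∣σ∣≡r)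
        in ℕP.n≮0 (z-bounded σ z≢0 i σ-earliest)
    ρ-spans-bounded (suc k) z z-cycle z-bounded =
      reduce (anySubset? λ c → ¬? (z c ≟ 0ℤ) ×-dec FinP.any? (λ i → toℕ i ℕ.≟ k ×-dec EarliestExtension? c i))
      where
      reduce : Dec (∃ λ c → z c ≢ 0ℤ × ∃ λ i → toℕ i ≡ k × EarliestExtension c i) → InSpan z
      reduce (no none) = ρ-spans-bounded k z z-cycle λ c zc≢0 i c-earliest →
        ℕP.≤∧≢⇒< (ℕP.≤-pred (z-bounded c zc≢0 i c-earliest)) λ toℕi≡k → none (c , zc≢0 , i , toℕi≡k , c-earliest)
      reduce (yes (c , zc≢0 , i , toℕi≡k , c-earliest)) =
        eliminate (latest-chain-basis k z z-cycle z-bounded c zc≢0 i toℕi≡k c-earliest)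
        where
        eliminate : ∃ (λ m → Basis m c × Ω i ≡ c ∪ ⁅ m ⁆) → InSpan z
        eliminate (m , b , Ωi≡c∪m) = lift (ρ-spans-bounded k z′ z′-cycle z′-bounded)
          where open LastChainElimination k z z-cycle z-bounded c zc≢0 i toℕi≡k c-earliest m b Ωi≡c∪m

    ρ-spans : ∀ z → Cycle belowTop r z → InSpan z
    ρ-spans z z-cycle = ρ-spans-bounded N z z-cycle λ _ _ i _ → FinP.toℕ<n i

    ρ-homology-basis : IsHomologyBasis belowTop r Basis ρ
    ρ-homology-basis = (λ _ _ → ρ-cycle-belowTop) , spanning , ρ-independent
      where
      spanning : ∀ z → Cycle belowTop r z → Σ (Coeffs Basis) λ a →
                 ∃ λ d → SupportedOn belowTop (suc r) d × ∀ σ → z σ ≡ combination (proj₁ a) ρ σ + ∂ d σ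
      spanning z z-cycle =
        let (a , z≡) = ρ-spans z z-cycle
        in a , (λ _ → 0ℤ) , (λ _ 0≢0 → ⊥-elim (0≢0 refl)) , λ σ →
             trans (z≡ σ) (sym (trans (cong (combination (proj₁ a) ρ σ +_) (∂-zero (λ _ → 0ℤ) (λ _ → refl) σ))
                                      (ℤP.+-identityʳ _)))

lemma2p2 : ∀ {n : ℕ} (P : FinPoset n) (r : ℕ) → let open Poset P in
    PureOfLength r →
    ∀ (N : ℕ) (Ω : Fin N → Subset n) → IsShellingOrder N Ω →
    Acyclic whole →
    let open Induced Ω in
      -- (i) 𝓕(P ∖ M) = ⨄_{m ∈ M} 𝓕(P_{<m})
      ((∀ c → 𝓕BelowTop c → ∃ λ m → IsMaximal m × 𝓕Below m c)
       × (∀ m c → IsMaximal m → 𝓕Below m c → 𝓕BelowTop c)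
       × (∀ m m' c → IsMaximal m → IsMaximal m' → 𝓕Below m c → 𝓕Below m' c → m ≡ m'))
      -- (ii) for the shelling bases B(P_{<m}) = {ρ m F}, their union is a
      --      basis of H_{r-1}(P ∖ M)
    × (∀ (ρ : Fin n → Subset n → ZChain) →
         (∀ m → IsMaximal m → ∀ F → 𝓕Below m F →
             Cycle (below m) r (ρ m F)
           × (∀ F' → 𝓕Below m F' → (F ≡ F' → ρ m F F' ≡ 1ℤ) × (F ≢ F' → ρ m F F' ≡ 0ℤ))) →
         IsHomologyBasis belowTop r (λ m F → IsMaximal m × 𝓕Below m F) ρ)
lemma2p2 P r pure _ Ω shelling acyclic =
  (𝓕BelowTop⇒𝓕Below , 𝓕Below⇒𝓕BelowTop , 𝓕Below-unique) ,
  λ ρ ρ-basis → ShellingBasis.ρ-homology-basis ρ ρ-basis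
  where open InducedShellings P r pure Ω shelling acyclic
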